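{- Let $q$ be an odd prime, let $n\ge 2$ be an integer and let $V\subsetneq\mathbb{F}_{q^n}$ be a proper $\mathbb{F}_q$-vector subspace. If $\#V\ge q^{3n/4}$, then for every $b\in\mathbb{F}_{q^n}^*$ the graph $\Gamma(Q_b,V)$ has diameter $2$, where $Q_b(X,Y)=X^2+bXY+Y^2$.
   Context: For a quadratic form $Q\in\mathbb{F}_{q^n}[X,Y]$ and an $\mathbb{F}_q$-vector subspace $V\subseteq\mathbb{F}_{q^n}$, $\Gamma(Q,V)$ is the graph with vertex set $\mathbb{F}_{q^n}$ and a directed edge $x\to y$ whenever $x\neq y$ and $Q(x,y)\in V$. For $Q=Q_b$ this relation is symmetric, so $\Gamma(Q_b,V)$ is regarded as an undirected simple graph. -}

module Defs where

open import Level using (0ℓ)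
open import Data.Nat as ℕ using (ℕ; zero; suc)
open import Data.Fin using (Fin)
open import Data.List using (List; length; filter; map)
open import Data.List.Base using (allFin)
open import Data.Product using (Σ; ∃; ∃-syntax; _×_; _,_)
open import Data.Sum using (_⊎_)
open import Relation.Nullary using (¬_)
open import Relation.Unary using (Pred; Decidable)
open import Relation.Binary.PropositionalEquality using (_≡_; _≢_)
open import Algebra.Structures using (IsCommutativeRing)
open import Function.Bundles using (_↔_)
open import Function.Base using (_∘_)

record FiniteField : Set₁ where
  infixl 7 _*_
  infixl 6 _+_
  field
    F       : Set
    _+_ _*_ : F → F → F
    -_      : F → F
    0# 1#   : F
    isCommutativeRing : IsCommutativeRing _≡_ _+_ _*_ -_ 0# 1#
    0≢1     : 0# ≢ 1#
    inverse : ∀ x → x ≢ 0# → ∃[ y ] (x * y ≡ 1#)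
    size    : ℕ
    enum    : Fin size ↔ F

  _^_ : F → ℕ → F
  x ^ zero  = 1#
  x ^ suc k = x * (x ^ k)

  -- The subfield 𝔽_q (for q the characteristic) is {c | c ^ q ≡ c}.
  InPrimeSubfield : ℕ → F → Set
  InPrimeSubfield q c = c ^ q ≡ c

  record IsSubspace (q : ℕ) (V : Pred F 0ℓ) : Set where
    field
      zero∈ : V 0#
      +-closed : ∀ {x y} → V x → V y → V (x + y)
      scalar-closed : ∀ {c x} → InPrimeSubfield q c → V x → V (c * x)

  card : {V : Pred F 0ℓ} → Decidable V → ℕ
  card V? = length (filter V? (map (Inverse.to enum) (allFin size)))
    where open Function.Bundles using (Inverse)

  Qb : F → F → F → F
  Qb b x y = x * x + b * x * y + y * y

  Adj : F → Pred F 0ℓ → F → F → Set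
  Adj b V x y = x ≢ y × V (Qb b x y)

  Within : (F → F → Set) → ℕ → F → F → Set
  Within E zero    x y = x ≡ y
  Within E (suc k) x y = x ≡ y ⊎ ∃[ z ] (E x z × Within E k z y)

  HasDiameter : (F → F → Set) → ℕ → Set
  HasDiameter E d =
    (∀ x y → Within E d x y) ×
    (∀ k → k ℕ.< d → ∃[ x ] ∃[ y ] ¬ Within E k x y)

-- Fix x ≠ y. Since Q_b(x,z) - Q_b(z,y) = b(x - y) z + (x² - y²) with b(x - y) ≠ 0, the z with
-- Q_b(x,z) ≡ Q_b(z,y) mod V form an affine copy Z of V, and the common neighbours of x and y are,
-- up to x and y themselves, the N points z ∈ Z with Q_b(x,z) ∈ V. For t ∈ 𝔽 let n_t count the
-- z ∈ Z with Q_b(x,z) ≡ t mod V: then n_t = N on V, ∑ n_t = |V|² and ∑ n_t² = |V| S, where S counts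
-- the pairs z, z' ∈ Z with Q_b(x,z) ≡ Q_b(x,z') mod V. Cauchy–Schwarz over t ∉ V gives
-- (|V|² - |V| N)² ≤ (q^n - |V|)(|V| S - |V| N²), and together with q^n S ≤ |V|³ + q^n (q^n - |V|)
-- and q^{3n} ≤ |V|⁴ this forces N ≥ 3.
--
-- The bound on S replaces the character sums of the paper. Substituting z' = z - h shows S is at
-- most the number of pairs h, w ∈ W = (b(x - y))⁻¹V with h w ∈ V. Fix an additive subgroup H of
-- index q (built by adjoining elements one at a time) and put X⟂ = {a : a X ⊆ H}. Double counting
-- gives |X⟂| |X| = q^n and X⟂⟂ = X, and counting the triples (h, w, α) ∈ W × W × V⟂ with
-- h w α ∈ H in two ways bounds that number of pairs.
--
-- The diameter is not 1: some s has s² ∉ V, because u = ((u + 1)/2)² - ((u - 1)/2)² for u ∉ V,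
-- so s and 0 are not adjacent.

module Submission where

open import Defs
open import Level using (0ℓ)
open import Algebra.Bundles using (CommutativeMonoid; CommutativeRing; RawRing)
open import Algebra.Structures using (IsCommutativeRing)
import Algebra.Solver.CommutativeMonoid
open import Data.Bool.Base using (Bool; true; false; not; _∧_; if_then_else_)
open import Data.Bool.Properties using (⇔→≡; not-injective; ∧-identityʳ; ∧-zeroʳ)
open import Data.Empty using (⊥; ⊥-elim)
open import Data.Fin.Base using (Fin; zero; suc; toℕ)
import Data.Fin.Properties as Fin
open import Data.Fin.Permutation using (Permutation)
open import Data.List.Base using (length; filter; tabulate)
open import Data.List.Properties using (map-tabulate)
open import Data.Nat.Base as ℕ using (ℕ; zero; suc; _≤_; _<_; z≤n; s≤s; >-nonZero)
import Data.Nat.Properties as ℕ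
open import Data.Nat.Coprimality using (prime⇒coprime; coprime-Bézout)
open import Data.Nat.DivMod using (_divMod_; result)
open import Data.Nat.GCD using (module Bézout)
open import Data.Nat.Primality using (Prime; prime⇒nonZero; prime⇒nonTrivial)
open import Data.Nat.Tactic.RingSolver using (solve-∀)
open import Data.Product.Base using (∃-syntax; _×_; _,_; proj₁; proj₂)
open import Data.Sum.Base using (inj₁; inj₂)
open import Data.Vec.Functional using (Vector)
open import Function.Base using (_∘_)
open import Function.Bundles using (Inverse; _↔_; mk↔ₛ′; mk⇔)
open import Function.Construct.Composition using (_↔-∘_)
open import Function.Construct.Identity using (↔-id)
open import Function.Construct.Symmetry using (↔-sym)
open import Function.Properties.Inverse using (Inverse⇒Injection)
open import Relation.Binary.Definitions using (DecidableEquality; tri<; tri≈; tri>)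
open import Relation.Binary.PropositionalEquality
open import Relation.Nullary.Decidable using (Dec; does; yes; no; via-injection; dec-true; dec-false)
open import Relation.Nullary.Negation using (¬_; contradiction)
open import Relation.Unary using (Pred; Decidable)

∧-not≡true⇒ : ∀ {a b} → a ∧ not b ≡ true → a ≡ true × b ≡ false
∧-not≡true⇒ {true} {false} _ = refl , refl

∧-true⇒ : ∀ {a b} → a ∧ b ≡ true → a ≡ true × b ≡ true
∧-true⇒ {true} {true} _ = refl , refl

∧-true⇐ : ∀ {a b} → a ≡ true → b ≡ true → a ∧ b ≡ true
∧-true⇐ refl refl = refl

does⇒ : ∀ {B : Set} (b? : Dec B) → does b? ≡ true → B
does⇒ (yes b) _ = b

module NatInequalities where
  open import Data.Nat.Base using (_+_; _*_; _∸_)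

  private
    2mn≤m²+n²-ordered : ∀ {m n} → m ≤ n → 2 * (m * n) ≤ m * m + n * n
    2mn≤m²+n²-ordered {m} {n} m≤n = subst (λ k → 2 * (m * k) ≤ m * m + k * k) (ℕ.m+[n∸m]≡n m≤n)
      (subst (2 * (m * (m + d)) ≤_) (identity m d) (ℕ.m≤m+n _ (d * d)))
      where
        d = n ∸ m
        identity : ∀ a d → 2 * (a * (a + d)) + d * d ≡ a * a + (a + d) * (a + d)
        identity = solve-∀

  2mn≤m²+n² : ∀ m n → 2 * (m * n) ≤ m * m + n * n
  2mn≤m²+n² m n with ℕ.≤-total m n
  ... | inj₁ m≤n = 2mn≤m²+n²-ordered m≤n
  ... | inj₂ n≤m = subst₂ _≤_ (cong (2 *_) (ℕ.*-comm n m)) (ℕ.+-comm (n * n) (m * m)) (2mn≤m²+n²-ordered n≤m)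

  private
    ≤-cancel-square : ∀ {v} d {c S} → 1 ≤ v → (v * d) * (v * d) ≤ c * (v * S) → v * (d * d) ≤ c * S
    ≤-cancel-square {v} d {c} {S} 1≤v le = ℕ.*-cancelˡ-≤ v {{>-nonZero 1≤v}}
      (subst₂ _≤_ (regroupˡ v d) (regroupʳ v c S) le)
      where
        regroupˡ : ∀ v d → (v * d) * (v * d) ≡ v * (v * (d * d))
        regroupˡ = solve-∀
        regroupʳ : ∀ v c S → c * (v * S) ≡ v * (c * S)
        regroupʳ = solve-∀

  variance-bound : ∀ {v N S T U c} → 1 ≤ v →
    T + v * N ≡ v * v → U + v * (N * N) ≡ v * S → T * T ≤ c * U →
    ∃[ d ] v ≡ N + d × v * (d * d) ≤ c * S
  variance-bound {v} {N} {S} {T} {U} {c} 1≤v first second cs =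
    d , sym (ℕ.m+[n∸m]≡n N≤v) , ≤-cancel-square d {c} {S} 1≤v (ℕ.≤-trans (subst (λ t → t * t ≤ c * U) T≡vd cs) (ℕ.*-monoʳ-≤ c U≤vS))
    where
      open ≡-Reasoning
      d = v ∸ N
      N≤v : N ≤ v
      N≤v = ℕ.*-cancelˡ-≤ v {{>-nonZero 1≤v}} (subst (v * N ≤_) first (ℕ.m≤n+m (v * N) T))
      T≡vd : T ≡ v * d
      T≡vd = ℕ.+-cancelʳ-≡ (v * N) T (v * d) (begin
        T + v * N       ≡⟨ first ⟩
        v * v           ≡⟨ cong (v *_) (ℕ.m+[n∸m]≡n N≤v) ⟨
        v * (N + d)     ≡⟨ ℕ.*-distribˡ-+ v N d ⟩
        v * N + v * d   ≡⟨ ℕ.+-comm (v * N) (v * d) ⟩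
        v * d + v * N   ∎)
      U≤vS : U ≤ v * S
      U≤vS = subst (U ≤_) second (ℕ.m≤m+n U (v * (N * N)))

  variance-bound⇒3≤N : ∀ {c d N S v f} → v ≡ N + d → f ≡ c + v →
    v * (d * d) ≤ c * S → f * S + f * v ≤ v * v * v + f * f →
    f * f * f ≤ v * v * v * v → 2 * v ≤ c → 1 ≤ v → 3 ≤ N
  variance-bound⇒3≤N {c} {d} {N} {S} {v} {f} refl refl vd²≤cS fS+fv≤ f³≤v⁴ 2v≤c 1≤v = ℕ.≰⇒> N≰2
    where
      open ℕ.≤-Reasoning
      L R : ℕ
      L = f * (v * (d * d)) + c * (f * v)
      R = c * (v * v * v + f * f)
      L≤R : L ≤ R
      L≤R = begin
        f * (v * (d * d)) + c * (f * v) ≤⟨ ℕ.+-monoˡ-≤ (c * (f * v)) (ℕ.*-monoʳ-≤ f vd²≤cS) ⟩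
        f * (c * S) + c * (f * v)       ≡⟨ regroup f c S v ⟩
        c * (f * S + f * v)             ≤⟨ ℕ.*-monoʳ-≤ c fS+fv≤ ⟩
        R                               ∎
        where regroup : ∀ f c S v → f * (c * S) + c * (f * v) ≡ c * (f * S + f * v)
              regroup = solve-∀
      -- R + v⁴ + 2f²v + N²fv = L + f³ + (2N+1)fv², written in the independent variables c, N, d
      identity : ∀ c N d → let v = N + d; f = c + v in
        c * (v * v * v + f * f) + v * v * v * v + (2 * (f * f * v) + N * N * f * v) ≡
        f * (v * (d * d)) + c * (f * v) + f * f * f + (2 * N + 1) * (f * v * v)
      identity = solve-∀
      2f²v≤[2N+1]fv² : 2 * (f * f * v) ≤ (2 * N + 1) * (f * v * v)
      2f²v≤[2N+1]fv² = ℕ.≤-trans (ℕ.m≤m+n _ (N * N * f * v)) (ℕ.+-cancelˡ-≤ (L + f * f * f) _ _ (begin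
        L + f * f * f + (2 * (f * f * v) + N * N * f * v)       ≤⟨ ℕ.+-monoˡ-≤ _ (ℕ.+-mono-≤ L≤R f³≤v⁴) ⟩
        R + v * v * v * v + (2 * (f * f * v) + N * N * f * v)   ≡⟨ identity c N d ⟩
        L + f * f * f + (2 * N + 1) * (f * v * v)               ∎))
      2f≤[2N+1]v : 2 * f ≤ (2 * N + 1) * v
      2f≤[2N+1]v = ℕ.*-cancelˡ-≤ (f * v) {{>-nonZero (ℕ.*-mono-≤ (ℕ.≤-trans 1≤v (ℕ.m≤n+m v c)) 1≤v)}} (subst₂ _≤_ (regroup f v) (regroup′ N f v) 2f²v≤[2N+1]fv²)
        where regroup : ∀ f v → 2 * (f * f * v) ≡ f * v * (2 * f)
              regroup = solve-∀
              regroup′ : ∀ N f v → (2 * N + 1) * (f * v * v) ≡ f * v * ((2 * N + 1) * v)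
              regroup′ = solve-∀
      N≰2 : ¬ N ≤ 2
      N≰2 N≤2 = ℕ.<⇒≱ (ℕ.*-monoˡ-< v {{>-nonZero 1≤v}} (ℕ.n<1+n 5)) (begin
        6 * v           ≡⟨ six v ⟩
        2 * (2 * v + v) ≤⟨ ℕ.*-monoʳ-≤ 2 (ℕ.+-monoˡ-≤ v 2v≤c) ⟩
        2 * f           ≤⟨ 2f≤[2N+1]v ⟩
        (2 * N + 1) * v ≤⟨ ℕ.*-monoˡ-≤ v (ℕ.+-monoˡ-≤ 1 (ℕ.*-monoʳ-≤ 2 N≤2)) ⟩
        5 * v           ∎)
        where six : ∀ v → 6 * v ≡ 2 * (2 * v + v)
              six = solve-∀

open NatInequalities

module FiniteSum {c ℓ} (M : CommutativeMonoid c ℓ) {A : Set} {n : ℕ} (enum : Fin n ↔ A) where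
  open CommutativeMonoid M using (Carrier; _≈_; identityˡ; identityʳ) renaming (_∙_ to _+_; ε to 0#; ∙-congˡ to +-congˡ)
  module M = CommutativeMonoid M
  open import Algebra.Properties.CommutativeMonoid.Sum M
  open import Algebra.Definitions.RawMonoid M.rawMonoid using () renaming (_×_ to _·_)
  open import Relation.Binary.Reasoning.Setoid M.setoid
  open Inverse enum using (to; from; strictlyInverseˡ; strictlyInverseʳ)

  _≟_ : DecidableEquality A
  _≟_ = via-injection (Inverse⇒Injection (↔-sym enum)) Fin._≟_

  ∑ : (A → Carrier) → Carrier
  ∑ f = sum (f ∘ to)

  ∑-cong : ∀ {f g : A → Carrier} → (∀ x → f x ≈ g x) → ∑ f ≈ ∑ g
  ∑-cong f≈g = sum-cong-≋ (f≈g ∘ to)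

  ∑-+ : ∀ (f g : A → Carrier) → ∑ (λ x → f x + g x) ≈ ∑ f + ∑ g
  ∑-+ f g = ∑-distrib-+ (f ∘ to) (g ∘ to)

  ∑-swap : ∀ (f : A → A → Carrier) → ∑ (λ x → ∑ (f x)) ≈ ∑ (λ y → ∑ (λ x → f x y))
  ∑-swap f = ∑-comm (λ i j → f (to i) (to j))

  ∑-swap-sum : ∀ {m} (f : A → Fin m → Carrier) → ∑ (λ x → sum (f x)) ≈ sum (λ k → ∑ (λ x → f x k))
  ∑-swap-sum f = ∑-comm (λ i k → f (to i) k)

  ∑-const : ∀ k → ∑ (λ _ → k) ≈ n · k
  ∑-const k = sum-replicate n

  ∑-reindex : ∀ (σ : A ↔ A) (f : A → Carrier) → ∑ (f ∘ Inverse.to σ) ≈ ∑ f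
  ∑-reindex σ f = M.sym (begin
    sum (f ∘ to)                  ≈⟨ sum-permute (f ∘ to) π ⟩
    sum (f ∘ to ∘ from ∘ σ.to ∘ to) ≡⟨ sum-cong-≗ (λ i → cong f (strictlyInverseˡ (σ.to (to i)))) ⟩
    sum (f ∘ σ.to ∘ to)           ∎)
    where
      module σ = Inverse σ
      π : Permutation n n
      π = ↔-sym enum ↔-∘ (σ ↔-∘ enum)

  private
    sum-δ : ∀ {m} (j : Fin m) (t : Vector Carrier m) →
            sum (λ i → if does (i Fin.≟ j) then t i else 0#) ≈ t j
    sum-δ {suc m} zero t = M.trans (+-congˡ (sum-replicate-zero m)) (identityʳ (t zero))
    sum-δ {suc m} (suc j) t = M.trans (identityˡ _) (sum-δ j (t ∘ suc))

  ∑-δ : ∀ x (f : A → Carrier) → ∑ (λ y → if does (y ≟ x) then f y else 0#) ≈ f x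
  ∑-δ x f = begin
    sum (λ i → if does (from (to i) Fin.≟ from x) then f (to i) else 0#)
      ≡⟨ sum-cong-≗ (λ i → cong (λ j → if does (j Fin.≟ from x) then f (to i) else 0#) (strictlyInverseʳ i)) ⟩
    sum (λ i → if does (i Fin.≟ from x) then f (to i) else 0#)
      ≈⟨ sum-δ (from x) (f ∘ to) ⟩
    f (to (from x))
      ≡⟨ cong f (strictlyInverseˡ x) ⟩
    f x ∎

module Counting {A : Set} {n : ℕ} (enum : Fin n ↔ A) where
  open import Data.Nat.Base using (_+_; _*_; _∸_)
  open FiniteSum ℕ.+-0-commutativeMonoid enum public hiding (∑-const)
  open import Algebra.Properties.Semiring.Sum ℕ.+-*-semiring using (sum; *-distribˡ-sum)
  open Inverse enum using (to)

  ∑-const : ∀ k → ∑ (λ _ → k) ≡ n * k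
  ∑-const k = go n
    where
      go : ∀ m → sum {m} (λ _ → k) ≡ m * k
      go zero = refl
      go (suc m) = cong (k +_) (go m)

  ∑-*ˡ : ∀ k (f : A → ℕ) → ∑ (λ x → k * f x) ≡ k * ∑ f
  ∑-*ˡ k f = sym (*-distribˡ-sum k (f ∘ to))

  ∑-*ʳ : ∀ k (f : A → ℕ) → ∑ (λ x → f x * k) ≡ ∑ f * k
  ∑-*ʳ k f = trans (∑-cong (λ x → ℕ.*-comm (f x) k)) (trans (∑-*ˡ k f) (ℕ.*-comm k (∑ f)))

  private
    sum-mono : ∀ {m} {s t : Vector ℕ m} → (∀ i → s i ≤ t i) → sum s ≤ sum t
    sum-mono {zero} _ = z≤n
    sum-mono {suc m} s≤t = ℕ.+-mono-≤ (s≤t zero) (sum-mono (s≤t ∘ suc))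

    sum-pos : ∀ {m} (t : Vector ℕ m) → 0 < sum t → ∃[ i ] 0 < t i
    sum-pos {suc m} t 0<sum with t zero in t0≡
    ... | suc _ = zero , subst (0 <_) (sym t0≡) (s≤s z≤n)
    ... | zero with sum-pos (t ∘ suc) 0<sum
    ...   | i , 0<ti = suc i , 0<ti

  ∑-mono : ∀ {f g : A → ℕ} → (∀ x → f x ≤ g x) → ∑ f ≤ ∑ g
  ∑-mono f≤g = sum-mono (f≤g ∘ to)

  ∑-pos⇒∃ : ∀ (f : A → ℕ) → 0 < ∑ f → ∃[ x ] 0 < f x
  ∑-pos⇒∃ f 0<∑ with sum-pos (f ∘ to) 0<∑
  ... | i , 0<fi = to i , 0<fi

  term≤∑ : ∀ (f : A → ℕ) x → f x ≤ ∑ f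
  term≤∑ f x = subst (_≤ ∑ f) (∑-δ x f) (∑-mono point≤)
    where
      point≤ : ∀ y → (if does (y ≟ x) then f y else 0) ≤ f y
      point≤ y with does (y ≟ x)
      ... | true = ℕ.≤-refl
      ... | false = z≤n

  ∑-mono-≡⇒≡ : ∀ {f g : A → ℕ} → (∀ x → f x ≤ g x) → ∑ f ≡ ∑ g → ∀ x → f x ≡ g x
  ∑-mono-≡⇒≡ {f} {g} f≤g ∑f≡∑g x = sym (begin
      g x       ≡⟨ f+d≡g x ⟨
      f x + d x ≡⟨ cong (f x +_) (ℕ.n≤0⇒n≡0 (subst (d x ≤_) ∑d≡0 (term≤∑ d x))) ⟩
      f x + 0   ≡⟨ ℕ.+-identityʳ (f x) ⟩
      f x       ∎)
    where
      open ≡-Reasoning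
      d : A → ℕ
      d y = g y ∸ f y
      f+d≡g : ∀ y → f y + d y ≡ g y
      f+d≡g y = ℕ.m+[n∸m]≡n (f≤g y)
      ∑d≡0 : ∑ d ≡ 0
      ∑d≡0 = ℕ.+-cancelˡ-≡ (∑ f) (∑ d) 0 (begin
        ∑ f + ∑ d        ≡⟨ ∑-+ f d ⟨
        ∑ (λ y → f y + d y) ≡⟨ ∑-cong f+d≡g ⟩
        ∑ g              ≡⟨ ∑f≡∑g ⟨
        ∑ f              ≡⟨ ℕ.+-identityʳ (∑ f) ⟨
        ∑ f + 0          ∎)

  𝟙 : Bool → ℕ
  𝟙 b = if b then 1 else 0

  𝟙-∧ : ∀ a b → 𝟙 (a ∧ b) ≡ 𝟙 a * 𝟙 b
  𝟙-∧ true b = sym (ℕ.+-identityʳ (𝟙 b))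
  𝟙-∧ false b = refl

  # : (A → Bool) → ℕ
  # P = ∑ (𝟙 ∘ P)

  infix 4 _∈_ _⊆_
  _∈_ : A → (A → Bool) → Set
  x ∈ P = P x ≡ true

  _⊆_ : (A → Bool) → (A → Bool) → Set
  P ⊆ Q = ∀ {x} → x ∈ P → x ∈ Q

  ∈⇒∉⇒⊥ : ∀ {P x} → x ∈ P → P x ≡ false → ⊥
  ∈⇒∉⇒⊥ x∈P x∉P = contradiction (trans (sym x∈P) x∉P) λ ()

  #-cong : ∀ {P Q : A → Bool} → (∀ x → P x ≡ Q x) → # P ≡ # Q
  #-cong P≡Q = ∑-cong (cong 𝟙 ∘ P≡Q)

  𝟙-mono : ∀ {P Q} → P ⊆ Q → ∀ x → 𝟙 (P x) ≤ 𝟙 (Q x)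
  𝟙-mono {P} {Q} P⊆Q x with P x in Px
  ... | false = z≤n
  ... | true rewrite P⊆Q Px = ℕ.≤-refl

  𝟙-injective : ∀ {a b} → 𝟙 a ≡ 𝟙 b → a ≡ b
  𝟙-injective {true} {true} _ = refl
  𝟙-injective {false} {false} _ = refl

  #-mono : ∀ {P Q} → P ⊆ Q → # P ≤ # Q
  #-mono {P} {Q} P⊆Q = ∑-mono (𝟙-mono {P} {Q} P⊆Q)

  ⊆∧#≡⇒≡ : ∀ {P Q} → P ⊆ Q → # P ≡ # Q → ∀ x → P x ≡ Q x
  ⊆∧#≡⇒≡ {P} {Q} P⊆Q #P≡#Q x = 𝟙-injective (∑-mono-≡⇒≡ (𝟙-mono {P} {Q} P⊆Q) #P≡#Q x)

  #-reindex : ∀ (σ : A ↔ A) (P : A → Bool) → # (P ∘ Inverse.to σ) ≡ # P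
  #-reindex σ P = ∑-reindex σ (𝟙 ∘ P)

  #-singleton : ∀ x → # (λ y → does (y ≟ x)) ≡ 1
  #-singleton x = ∑-δ x (λ _ → 1)

  #-all : # (λ _ → true) ≡ n
  #-all = trans (∑-const 1) (ℕ.*-identityʳ n)

  #-none : # (λ _ → false) ≡ 0
  #-none = trans (∑-const 0) (ℕ.*-zeroʳ n)

  #-complement : ∀ P → # P + # (not ∘ P) ≡ n
  #-complement P = trans (sym (∑-+ (𝟙 ∘ P) (𝟙 ∘ not ∘ P))) (trans (∑-cong (𝟙-+-not ∘ P)) #-all)
    where
      𝟙-+-not : ∀ b → 𝟙 b + 𝟙 (not b) ≡ 1
      𝟙-+-not true = refl
      𝟙-+-not false = refl

  member⇒1≤# : ∀ {P} x → x ∈ P → 1 ≤ # P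
  member⇒1≤# {P} x Px = subst (λ b → 𝟙 b ≤ # P) Px (term≤∑ (𝟙 ∘ P) x)

  1≤#⇒member : ∀ P → 1 ≤ # P → ∃[ x ] x ∈ P
  1≤#⇒member P 1≤#P with ∑-pos⇒∃ (𝟙 ∘ P) 1≤#P
  ... | x , 0<Px with P x in Px
  ...   | true = x , Px

  nonmember⇒#<n : ∀ {P} x → P x ≡ false → # P < n
  nonmember⇒#<n {P} x Px = subst (# P <_) (#-complement P)
    (ℕ.m<m+n (# P) (member⇒1≤# {not ∘ P} x (cong not Px)))

  #<n⇒nonmember : ∀ P → # P < n → ∃[ x ] P x ≡ false
  #<n⇒nonmember P #P<n with 1≤#⇒member (not ∘ P) 1≤#notP
    where
      1≤#notP : 1 ≤ # (not ∘ P)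
      1≤#notP = ℕ.+-cancelˡ-< (# P) 0 (# (not ∘ P))
        (subst₂ _<_ (sym (ℕ.+-identityʳ (# P))) (sym (#-complement P)) #P<n)
  ... | x , notPx with P x in Px
  ...   | false = x , Px

  _without_ : (A → Bool) → A → A → Bool
  (P without c) x = P x ∧ not (does (x ≟ c))

  #≤1+#-without : ∀ P c → # P ≤ 1 + # (P without c)
  #≤1+#-without P c = subst (# P ≤_) (trans (∑-+ atC rest) (cong (_+ # (P without c)) (∑-δ c (λ _ → 1))))
    (∑-mono point≤)
    where
      atC rest : A → ℕ
      atC x = if does (x ≟ c) then 1 else 0
      rest x = 𝟙 ((P without c) x)
      point≤ : ∀ x → 𝟙 (P x) ≤ atC x + rest x
      point≤ x with does (x ≟ c) | P x
      ... | true | true = s≤s z≤n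
      ... | true | false = z≤n
      ... | false | true = ℕ.≤-refl
      ... | false | false = z≤n

  ∑-product : ∀ (f g : A → ℕ) → ∑ (λ x → ∑ (λ y → f x * g y)) ≡ ∑ f * ∑ g
  ∑-product f g = trans (∑-cong (λ x → ∑-*ˡ (f x) g)) (∑-*ʳ (∑ g) f)

  cauchy-schwarz : ∀ (w g : A → ℕ) →
    ∑ (λ x → w x * g x) * ∑ (λ x → w x * g x) ≤ ∑ w * ∑ (λ x → w x * (g x * g x))
  cauchy-schwarz w g = ℕ.*-cancelˡ-≤ 2 (subst₂ _≤_ twice-square twice-product (∑-mono (λ x → ∑-mono (λ y →
    ℕ.*-monoʳ-≤ (w x * w y) (2mn≤m²+n² (g x) (g y))))))
    where
      wg wg² : A → ℕ
      wg x = w x * g x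
      wg² x = w x * (g x * g x)
      twice-square : ∑ (λ x → ∑ (λ y → w x * w y * (2 * (g x * g y)))) ≡ 2 * (∑ wg * ∑ wg)
      twice-square = begin
        ∑ (λ x → ∑ (λ y → w x * w y * (2 * (g x * g y))))
          ≡⟨ ∑-cong (λ x → ∑-cong (λ y → regroup (w x) (w y) (g x) (g y))) ⟩
        ∑ (λ x → ∑ (λ y → 2 * (wg x * wg y)))
          ≡⟨ ∑-cong (λ x → ∑-*ˡ 2 (λ y → wg x * wg y)) ⟩
        ∑ (λ x → 2 * ∑ (λ y → wg x * wg y))
          ≡⟨ ∑-*ˡ 2 (λ x → ∑ (λ y → wg x * wg y)) ⟩
        2 * ∑ (λ x → ∑ (λ y → wg x * wg y))
          ≡⟨ cong (2 *_) (∑-product wg wg) ⟩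
        2 * (∑ wg * ∑ wg) ∎
        where
          open ≡-Reasoning
          regroup : ∀ a b c d → a * b * (2 * (c * d)) ≡ 2 * ((a * c) * (b * d))
          regroup = solve-∀
      twice-product : ∑ (λ x → ∑ (λ y → w x * w y * (g x * g x + g y * g y))) ≡ 2 * (∑ w * ∑ wg²)
      twice-product = begin
        ∑ (λ x → ∑ (λ y → w x * w y * (g x * g x + g y * g y)))
          ≡⟨ ∑-cong (λ x → ∑-cong (λ y → regroup (w x) (w y) (g x) (g y))) ⟩
        ∑ (λ x → ∑ (λ y → wg² x * w y + w x * wg² y))
          ≡⟨ ∑-cong (λ x → ∑-+ (λ y → wg² x * w y) (λ y → w x * wg² y)) ⟩
        ∑ (λ x → ∑ (λ y → wg² x * w y) + ∑ (λ y → w x * wg² y))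
          ≡⟨ ∑-+ (λ x → ∑ (λ y → wg² x * w y)) (λ x → ∑ (λ y → w x * wg² y)) ⟩
        ∑ (λ x → ∑ (λ y → wg² x * w y)) + ∑ (λ x → ∑ (λ y → w x * wg² y))
          ≡⟨ cong₂ _+_ (∑-product wg² w) (∑-product w wg²) ⟩
        ∑ wg² * ∑ w + ∑ w * ∑ wg²
          ≡⟨ double (∑ wg²) (∑ w) ⟩
        2 * (∑ w * ∑ wg²) ∎
        where
          open ≡-Reasoning
          regroup : ∀ a b c d → a * b * (c * c + d * d) ≡ a * (c * c) * b + a * (b * (d * d))
          regroup = solve-∀
          double : ∀ s t → s * t + t * s ≡ 2 * (t * s)
          double = solve-∀

  anyᵇ : (A → Bool) → Bool
  anyᵇ P = does (1 ℕ.≤? # P)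

  anyᵇ-intro : ∀ {P} x → x ∈ P → anyᵇ P ≡ true
  anyᵇ-intro {P} x x∈P = dec-true (1 ℕ.≤? # P) (member⇒1≤# x x∈P)

  anyᵇ-elim : ∀ P → anyᵇ P ≡ true → ∃[ x ] x ∈ P
  anyᵇ-elim P = 1≤#⇒member P ∘ does⇒ (1 ℕ.≤? # P)

  anyᵇ-false : ∀ {P} → anyᵇ P ≡ false → ∀ x → P x ≡ false
  anyᵇ-false {P} any-false x with P x in Px
  ... | false = refl
  ... | true = contradiction (trans (sym (anyᵇ-intro x Px)) any-false) λ ()

  anyᵇ-none : ∀ {P} → (∀ x → P x ≡ false) → anyᵇ P ≡ false
  anyᵇ-none {P} none = dec-false (1 ℕ.≤? # P) λ 1≤#P → let x , x∈P = 1≤#⇒member P 1≤#P in ∈⇒∉⇒⊥ {P} x∈P (none x)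

  member-without : ∀ {P c x} → x ∈ P without c → x ∈ P × x ≢ c
  member-without {P} {c} {x} x∈ with ∧-not≡true⇒ x∈
  ... | x∈P , x≠c = x∈P , λ x≡c → contradiction (trans (sym (dec-true (x ≟ c) x≡c)) x≠c) λ ()

  unique⇒#≤1 : ∀ P → (∀ {x y} → x ∈ P → y ∈ P → x ≡ y) → # P ≤ 1
  unique⇒#≤1 P unique with 1 ℕ.≤? # P
  ... | no 1≰#P = ℕ.<⇒≤ (ℕ.≰⇒> 1≰#P)
  ... | yes 1≤#P with 1≤#⇒member P 1≤#P
  ...   | x , x∈P with # (P without x) in #rest
  ...     | zero = subst (# P ≤_) (cong suc #rest) (#≤1+#-without P x)
  ...     | suc _ with 1≤#⇒member (P without x) (subst (1 ≤_) (sym #rest) (s≤s z≤n))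
  ...       | y , y∈rest with member-without {P} y∈rest
  ...         | y∈P , y≢x = contradiction (unique y∈P x∈P) y≢x

  𝟙-anyᵇ : ∀ P → (∀ {x y} → x ∈ P → y ∈ P → x ≡ y) → 𝟙 (anyᵇ P) ≡ # P
  𝟙-anyᵇ P unique = 𝟙-1≤? (unique⇒#≤1 P unique)
    where
      𝟙-1≤? : ∀ {k} → k ≤ 1 → 𝟙 (does (1 ℕ.≤? k)) ≡ k
      𝟙-1≤? z≤n = refl
      𝟙-1≤? (s≤s z≤n) = refl

  ∑∈ : (A → Bool) → (A → ℕ) → ℕ
  ∑∈ P f = ∑ (λ x → 𝟙 (P x) * f x)

  syntax ∑∈ P (λ x → e) = ∑[ x ∈ P ] e

  ∑∈-cong : ∀ P {f g : A → ℕ} → (∀ {x} → x ∈ P → f x ≡ g x) → ∑∈ P f ≡ ∑∈ P g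
  ∑∈-cong P f≡g = ∑-cong pointwise
    where
      pointwise : ∀ x → 𝟙 (P x) * _ ≡ 𝟙 (P x) * _
      pointwise x with P x in Px
      ... | true = cong (1 *_) (f≡g Px)
      ... | false = refl

  ∑∈-mono : ∀ P {f g : A → ℕ} → (∀ {x} → x ∈ P → f x ≤ g x) → ∑∈ P f ≤ ∑∈ P g
  ∑∈-mono P f≤g = ∑-mono pointwise
    where
      pointwise : ∀ x → 𝟙 (P x) * _ ≤ 𝟙 (P x) * _
      pointwise x with P x in Px
      ... | true = ℕ.*-monoʳ-≤ 1 (f≤g Px)
      ... | false = z≤n

  ∑∈-*ˡ : ∀ k P (f : A → ℕ) → k * ∑∈ P f ≡ ∑[ x ∈ P ] (k * f x)
  ∑∈-*ˡ k P f = trans (sym (∑-*ˡ k (λ x → 𝟙 (P x) * f x))) (∑-cong (λ x → exchange k (𝟙 (P x)) (f x)))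
    where
      exchange : ∀ a b c → a * (b * c) ≡ b * (a * c)
      exchange = solve-∀

  ∑∈-affine : ∀ P (f : A → ℕ) c d → ∑[ x ∈ P ] (c + f x * d) ≡ # P * c + ∑∈ P f * d
  ∑∈-affine P f c d = begin
    ∑[ x ∈ P ] (c + f x * d)
      ≡⟨ ∑-cong (λ x → distribute (𝟙 (P x)) c (f x) d) ⟩
    ∑ (λ x → 𝟙 (P x) * c + 𝟙 (P x) * f x * d)
      ≡⟨ ∑-+ (λ x → 𝟙 (P x) * c) (λ x → 𝟙 (P x) * f x * d) ⟩
    ∑ (λ x → 𝟙 (P x) * c) + ∑ (λ x → 𝟙 (P x) * f x * d)
      ≡⟨ cong₂ _+_ (∑-*ʳ c (𝟙 ∘ P)) (∑-*ʳ d (λ x → 𝟙 (P x) * f x)) ⟩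
    # P * c + ∑∈ P f * d ∎
    where
      open ≡-Reasoning
      distribute : ∀ a c b d → a * (c + b * d) ≡ a * c + a * b * d
      distribute = solve-∀

  ∑∈-𝟙 : ∀ (P Q : A → Bool) → ∑[ x ∈ P ] 𝟙 (Q x) ≡ # (λ x → P x ∧ Q x)
  ∑∈-𝟙 P Q = ∑-cong (λ x → sym (𝟙-∧ (P x) (Q x)))

  ∑∈-swap : ∀ P Q (f : A → A → ℕ) → ∑[ x ∈ P ] ∑[ y ∈ Q ] f x y ≡ ∑[ y ∈ Q ] ∑[ x ∈ P ] f x y
  ∑∈-swap P Q f = begin
    ∑[ x ∈ P ] ∑[ y ∈ Q ] f x y
      ≡⟨ ∑-cong (λ x → ∑-*ˡ (𝟙 (P x)) (λ y → 𝟙 (Q y) * f x y)) ⟨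
    ∑ (λ x → ∑ (λ y → 𝟙 (P x) * (𝟙 (Q y) * f x y)))
      ≡⟨ ∑-swap (λ x y → 𝟙 (P x) * (𝟙 (Q y) * f x y)) ⟩
    ∑ (λ y → ∑ (λ x → 𝟙 (P x) * (𝟙 (Q y) * f x y)))
      ≡⟨ ∑-cong (λ y → ∑-cong (λ x → exchange (𝟙 (P x)) (𝟙 (Q y)) (f x y))) ⟩
    ∑ (λ y → ∑ (λ x → 𝟙 (Q y) * (𝟙 (P x) * f x y)))
      ≡⟨ ∑-cong (λ y → ∑-*ˡ (𝟙 (Q y)) (λ x → 𝟙 (P x) * f x y)) ⟩
    ∑[ y ∈ Q ] ∑[ x ∈ P ] f x y ∎
    where
      open ≡-Reasoning
      exchange : ∀ a b c → a * (b * c) ≡ b * (a * c)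
      exchange = solve-∀

  ∑∈-const : ∀ P c → ∑[ x ∈ P ] c ≡ # P * c
  ∑∈-const P c = ∑-*ʳ c (𝟙 ∘ P)

  ∑-split : ∀ P (f : A → ℕ) → ∑ f ≡ ∑∈ P f + ∑∈ (not ∘ P) f
  ∑-split P f = trans (∑-cong pointwise) (∑-+ (λ x → 𝟙 (P x) * f x) (λ x → 𝟙 (not (P x)) * f x))
    where
      pointwise : ∀ x → f x ≡ 𝟙 (P x) * f x + 𝟙 (not (P x)) * f x
      pointwise x with P x
      ... | true = sym (trans (ℕ.+-identityʳ _) (ℕ.+-identityʳ (f x)))
      ... | false = sym (ℕ.+-identityʳ (f x))

  ∑-∑∈-swap : ∀ Q (f : A → A → ℕ) → ∑ (λ x → ∑[ y ∈ Q ] f x y) ≡ ∑[ y ∈ Q ] ∑ (λ x → f x y)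
  ∑-∑∈-swap Q f = trans (∑-swap (λ x y → 𝟙 (Q y) * f x y)) (∑-cong (λ y → ∑-*ˡ (𝟙 (Q y)) (λ x → f x y)))

  ∑∈-product : ∀ P Q (f g : A → ℕ) → ∑∈ P f * ∑∈ Q g ≡ ∑[ x ∈ P ] ∑[ y ∈ Q ] (f x * g y)
  ∑∈-product P Q f g = trans (sym (∑-product (λ x → 𝟙 (P x) * f x) (λ y → 𝟙 (Q y) * g y)))
    (∑-cong λ x → trans (∑-cong (λ y → regroup (𝟙 (P x)) (f x) (𝟙 (Q y)) (g y))) (∑-*ˡ (𝟙 (P x)) (λ y → 𝟙 (Q y) * (f x * g y))))
    where
      regroup : ∀ a b c d → a * b * (c * d) ≡ a * (c * (b * d))
      regroup = solve-∀

  3≤#⇒member-avoiding : ∀ P x y → 3 ≤ # P → ∃[ z ] z ∈ P × z ≢ x × z ≢ y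
  3≤#⇒member-avoiding P x y 3≤#P with 1≤#⇒member ((P without x) without y) 1≤#
    where
      1≤# : 1 ≤ # ((P without x) without y)
      1≤# = ℕ.+-cancelˡ-≤ 2 1 _ (ℕ.≤-trans 3≤#P (ℕ.≤-trans (#≤1+#-without P x) (ℕ.+-monoʳ-≤ 1 (#≤1+#-without (P without x) y))))
  ... | z , z∈ with member-without {P without x} z∈
  ...   | z∈′ , z≢y with member-without {P} z∈′
  ...     | z∈P , z≢x = z , z∈P , z≢x , z≢y

-- Algebra.Solver.Ring needs coefficients with decidable equality, which an abstract ring lacks;
-- we use ℤ through its canonical image.
module IntegerCoefficients {c ℓ} (R : CommutativeRing c ℓ) where
  open import Data.Integer.Base as ℤ using (ℤ; +_; -[1+_]; _⊖_)
  import Data.Integer.Properties as ℤ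
  open import Data.Maybe.Base using (Maybe; just; nothing)
  open CommutativeRing R hiding (refl; sym; trans; reflexive; setoid; isEquivalence)
  module R = CommutativeRing R
  open import Algebra.Properties.Ring ring using (-‿involutive; -‿distribˡ-*; -‿distribʳ-*; -‿anti-homo-+; -0#≈0#)
  open import Algebra.Properties.Semiring.Mult semiring using (×-homo-+; ×1-homo-*) renaming (_×_ to _·_)
  open import Algebra.Solver.Ring.AlmostCommutativeRing
    using (AlmostCommutativeRing; fromCommutativeRing; _-Raw-AlmostCommutative⟶_)
  open import Relation.Binary.Reasoning.Setoid R.setoid
  module CM = Algebra.Solver.CommutativeMonoid +-commutativeMonoid
  open CM using (_⊕_; _⊜_)

  ⟦_⟧ : ℤ → Carrier
  ⟦ + n ⟧ = n · 1#
  ⟦ -[1+ n ] ⟧ = - (suc n · 1#)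

  private
    n×1 = λ n → n · 1#

    shift-by-1 : ∀ a b → a - b ≈ (1# + a) - (1# + b)
    shift-by-1 a b = R.sym (begin
      (1# + a) - (1# + b)
        ≈⟨ +-congˡ (-‿anti-homo-+ 1# b) ⟩
      (1# + a) + (- b - 1#)
        ≈⟨ CM.solve 4 (λ o a nb no → (o ⊕ a) ⊕ (nb ⊕ no) ⊜ (a ⊕ nb) ⊕ (o ⊕ no)) R.refl 1# a (- b) (- 1#) ⟩
      (a - b) + (1# - 1#)
        ≈⟨ +-congˡ (-‿inverseʳ 1#) ⟩
      (a - b) + 0#
        ≈⟨ +-identityʳ (a - b) ⟩
      a - b ∎)


    ⊖-homo : ∀ m n → ⟦ m ⊖ n ⟧ ≈ n×1 m - n×1 n
    ⊖-homo zero zero = R.sym (R.trans (+-congˡ -0#≈0#) (+-identityʳ 0#))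
    ⊖-homo zero (suc n) = R.sym (+-identityˡ _)
    ⊖-homo (suc m) zero = R.sym (R.trans (+-congˡ -0#≈0#) (+-identityʳ _))
    ⊖-homo (suc m) (suc n) = begin
      ⟦ suc m ⊖ suc n ⟧                   ≡⟨ cong ⟦_⟧ (ℤ.[1+m]⊖[1+n]≡m⊖n m n) ⟩
      ⟦ m ⊖ n ⟧                           ≈⟨ ⊖-homo m n ⟩
      n×1 m - n×1 n                       ≈⟨ shift-by-1 (n×1 m) (n×1 n) ⟩
      (1# + n×1 m) - (1# + n×1 n)         ∎


    neg-homo : ∀ i → ⟦ ℤ.- i ⟧ ≈ - ⟦ i ⟧
    neg-homo (+ zero) = R.sym -0#≈0#
    neg-homo (+ suc n) = R.refl
    neg-homo -[1+ n ] = R.sym (-‿involutive _)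

    +-homo : ∀ i j → ⟦ i ℤ.+ j ⟧ ≈ ⟦ i ⟧ + ⟦ j ⟧
    +-homo (+ m) (+ n) = ×-homo-+ 1# m n
    +-homo (+ m) -[1+ n ] = ⊖-homo m (suc n)
    +-homo -[1+ m ] (+ n) = R.trans (⊖-homo n (suc m)) (+-comm _ _)
    +-homo -[1+ m ] -[1+ n ] = begin
      - n×1 (suc (suc (m ℕ.+ n)))     ≡⟨ cong (λ k → - n×1 (suc k)) (ℕ.+-suc m n) ⟨
      - n×1 (suc m ℕ.+ suc n)         ≈⟨ -‿cong (×-homo-+ 1# (suc m) (suc n)) ⟩
      - (n×1 (suc m) + n×1 (suc n))   ≈⟨ -‿cong (+-comm _ _) ⟩
      - (n×1 (suc n) + n×1 (suc m))   ≈⟨ -‿anti-homo-+ _ _ ⟩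
      - n×1 (suc m) + - n×1 (suc n)   ∎

    +-*-homo : ∀ m n → ⟦ + m ℤ.* + n ⟧ ≈ n×1 m * n×1 n
    +-*-homo m n = R.trans (R.reflexive (cong ⟦_⟧ (sym (ℤ.pos-* m n)))) (×1-homo-* m n)

    *-homo : ∀ i j → ⟦ i ℤ.* j ⟧ ≈ ⟦ i ⟧ * ⟦ j ⟧
    *-homo (+ m) (+ n) = +-*-homo m n
    *-homo (+ m) -[1+ n ] = begin
      ⟦ + m ℤ.* ℤ.- + suc n ⟧       ≡⟨ cong ⟦_⟧ (ℤ.neg-distribʳ-* (+ m) (+ suc n)) ⟨
      ⟦ ℤ.- (+ m ℤ.* + suc n) ⟧     ≈⟨ neg-homo (+ m ℤ.* + suc n) ⟩
      - ⟦ + m ℤ.* + suc n ⟧         ≈⟨ -‿cong (+-*-homo m (suc n)) ⟩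
      - (n×1 m * n×1 (suc n))       ≈⟨ -‿distribʳ-* _ _ ⟩
      n×1 m * - n×1 (suc n)         ∎
    *-homo -[1+ m ] (+ n) = begin
      ⟦ ℤ.- + suc m ℤ.* + n ⟧       ≡⟨ cong ⟦_⟧ (ℤ.neg-distribˡ-* (+ suc m) (+ n)) ⟨
      ⟦ ℤ.- (+ suc m ℤ.* + n) ⟧     ≈⟨ neg-homo (+ suc m ℤ.* + n) ⟩
      - ⟦ + suc m ℤ.* + n ⟧         ≈⟨ -‿cong (+-*-homo (suc m) n) ⟩
      - (n×1 (suc m) * n×1 n)       ≈⟨ -‿distribˡ-* _ _ ⟩
      - n×1 (suc m) * n×1 n         ∎
    *-homo -[1+ m ] -[1+ n ] = begin
      ⟦ + suc m ℤ.* + suc n ⟧         ≈⟨ +-*-homo (suc m) (suc n) ⟩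
      n×1 (suc m) * n×1 (suc n)       ≈⟨ -‿involutive _ ⟨
      - - (n×1 (suc m) * n×1 (suc n)) ≈⟨ -‿cong (-‿distribˡ-* _ _) ⟩
      - (- n×1 (suc m) * n×1 (suc n)) ≈⟨ -‿distribʳ-* _ _ ⟩
      - n×1 (suc m) * - n×1 (suc n)   ∎

    ℤ-rawRing : RawRing 0ℓ 0ℓ
    ℤ-rawRing = record { Carrier = ℤ ; _≈_ = _≡_ ; _+_ = ℤ._+_ ; _*_ = ℤ._*_ ; -_ = ℤ.-_ ; 0# = + 0 ; 1# = + 1 }

    ⟦⟧-morphism : ℤ-rawRing -Raw-AlmostCommutative⟶ fromCommutativeRing R
    ⟦⟧-morphism = record
      { ⟦_⟧ = ⟦_⟧ ; +-homo = +-homo ; *-homo = *-homo ; -‿homo = neg-homo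
      ; 0-homo = R.refl ; 1-homo = +-identityʳ 1# }

    ⟦⟧-equal? : ∀ i j → Maybe (⟦ i ⟧ ≈ ⟦ j ⟧)
    ⟦⟧-equal? i j with i ℤ.≟ j
    ... | yes refl = just R.refl
    ... | no _ = nothing

  open import Algebra.Solver.Ring ℤ-rawRing (fromCommutativeRing R) ⟦⟧-morphism ⟦⟧-equal? public
    using (solve; _:=_; _:+_; _:*_; _:-_)

module FieldTheory (K : FiniteField) where
  open FiniteField K public
  open IsCommutativeRing isCommutativeRing public
    using (+-assoc; +-comm; *-assoc; *-comm; distribˡ; distribʳ; +-identityˡ; +-identityʳ;
           *-identityˡ; *-identityʳ; -‿inverseˡ; -‿inverseʳ; zeroˡ; zeroʳ)

  commutativeRing : CommutativeRing 0ℓ 0ℓ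
  commutativeRing = record { isCommutativeRing = isCommutativeRing }

  open CommutativeRing commutativeRing public using (_-_)
  open CommutativeRing commutativeRing using (+-commutativeMonoid; semiring)
  open Counting enum public
  module ΣF = FiniteSum +-commutativeMonoid enum
  open import Algebra.Properties.Monoid.Sum ℕ.+-0-monoid using (sum)
  open import Algebra.Properties.Semiring.Mult semiring public
    using (×-homo-+; ×-assocˡ; ×-assoc-*; ×1-homo-*) renaming (_×_ to _·_)
  open IntegerCoefficients commutativeRing public using (solve; _:=_; _:+_; _:*_; _:-_)

  1≢0 : 1# ≢ 0#
  1≢0 = 0≢1 ∘ sym

  no-zero-divisors : ∀ {a b} → a ≢ 0# → a * b ≡ 0# → b ≡ 0#
  no-zero-divisors {a} {b} a≢0 ab≡0 = begin
    b               ≡⟨ *-identityˡ b ⟨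
    1# * b          ≡⟨ cong (_* b) (trans (*-comm a⁻¹ a) aa⁻¹≡1) ⟨
    a⁻¹ * a * b     ≡⟨ *-assoc a⁻¹ a b ⟩
    a⁻¹ * (a * b)   ≡⟨ cong (a⁻¹ *_) ab≡0 ⟩
    a⁻¹ * 0#        ≡⟨ zeroʳ a⁻¹ ⟩
    0#              ∎
    where
      open ≡-Reasoning
      a⁻¹ = proj₁ (inverse a a≢0)
      aa⁻¹≡1 = proj₂ (inverse a a≢0)

  card≡# : ∀ {P : Pred F 0ℓ} (P? : Decidable P) → card P? ≡ # (λ u → does (P? u))
  card≡# {P} P? = trans (cong (length ∘ filter P?) (map-tabulate (λ i → i) (Inverse.to enum))) (length-filter (Inverse.to enum))
    where
      length-filter : ∀ {m} (g : Fin m → F) → length (filter P? (tabulate g)) ≡ sum (λ i → 𝟙 (does (P? (g i))))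
      length-filter {zero} g = refl
      length-filter {suc m} g with P? (g Fin.zero)
      ... | yes _ = cong suc (length-filter (g ∘ Fin.suc))
      ... | no _ = length-filter (g ∘ Fin.suc)

  ^≡0⇒≡0 : ∀ {a} k → a ^ k ≡ 0# → a ≡ 0#
  ^≡0⇒≡0 zero 1≡0 = contradiction 1≡0 1≢0
  ^≡0⇒≡0 {a} (suc k) aᵏ⁺¹≡0 with a ≟ 0#
  ... | yes a≡0 = a≡0
  ... | no a≢0 = ^≡0⇒≡0 k (no-zero-divisors a≢0 aᵏ⁺¹≡0)

  translation : F → F ↔ F
  translation c = mk↔ₛ′ (_+ c) (_+ - c)
    (λ y → solve 2 (λ y c → y :- c :+ c := y) refl y c)
    (λ y → solve 2 (λ y c → y :+ c :- c := y) refl y c)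

  scaling : ∀ a → a ≢ 0# → F ↔ F
  scaling a a≢0 = mk↔ₛ′ (a *_) (a⁻¹ *_)
    (λ y → trans (sym (*-assoc a a⁻¹ y)) (trans (cong (_* y) aa⁻¹≡1) (*-identityˡ y)))
    (λ y → trans (sym (*-assoc a⁻¹ a y)) (trans (cong (_* y) (trans (*-comm a⁻¹ a) aa⁻¹≡1)) (*-identityˡ y)))
    where
      a⁻¹ = proj₁ (inverse a a≢0)
      aa⁻¹≡1 = proj₂ (inverse a a≢0)

  reflection : F → F ↔ F
  reflection a = mk↔ₛ′ (λ t → a - t) (λ t → a - t) involutive involutive
    where
      involutive : ∀ t → a - (a - t) ≡ t
      involutive t = solve 2 (λ a t → a :- (a :- t) := t) refl a t

  #-translate : ∀ P c → # (λ y → P (y + c)) ≡ # P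
  #-translate P c = #-reindex (translation c) P

  #-mono-translate : ∀ {P Q} c → (∀ {z} → z ∈ P → z - c ∈ Q) → # P ≤ # Q
  #-mono-translate {P} {Q} c shift = ℕ.≤-trans (#-mono {P} {λ z → Q (z - c)} shift) (ℕ.≤-reflexive (#-translate Q (- c)))

  #-scale : ∀ P {a} → a ≢ 0# → # (λ y → P (a * y)) ≡ # P
  #-scale P a≢0 = #-reindex (scaling _ a≢0) P

  #-reflect : ∀ P a → # (λ t → P (a - t)) ≡ # P
  #-reflect P a = #-reindex (reflection a) P

  size·≡0 : ∀ x → size · x ≡ 0#
  size·≡0 x = begin
    size · x                          ≡⟨ solve 2 (λ a s → a := (a :+ s) :- s) refl (size · x) ∑y ⟩
    (size · x + ∑y) - ∑y              ≡⟨ cong (_- ∑y) ∑[x+y]≡∑y ⟩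
    ∑y - ∑y                           ≡⟨ -‿inverseʳ ∑y ⟩
    0#                                ∎
    where
      open ≡-Reasoning
      ∑y = ΣF.∑ (λ y → y)
      ∑[x+y]≡∑y : size · x + ∑y ≡ ∑y
      ∑[x+y]≡∑y = begin
        size · x + ∑y                 ≡⟨ cong (_+ ∑y) (ΣF.∑-const x) ⟨
        ΣF.∑ (λ _ → x) + ∑y           ≡⟨ ΣF.∑-+ (λ _ → x) (λ y → y) ⟨
        ΣF.∑ (λ y → x + y)            ≡⟨ ΣF.∑-cong (λ y → +-comm x y) ⟩
        ΣF.∑ (λ y → y + x)            ≡⟨ ΣF.∑-reindex (translation x) (λ y → y) ⟩
        ∑y                            ∎

  ·1-^ : ∀ m k → (m ℕ.^ k) · 1# ≡ (m · 1#) ^ k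
  ·1-^ m zero = +-identityʳ 1#
  ·1-^ m (suc k) = trans (×1-homo-* m (m ℕ.^ k)) (cong ((m · 1#) *_) (·1-^ m k))

  HasCharacteristic : ℕ → Set
  HasCharacteristic q = ∀ x → q · x ≡ 0#

  characteristic : ∀ {q n} → 1 ℕ.≤ n → size ≡ q ℕ.^ n → HasCharacteristic q
  characteristic {q} {n} 1≤n size≡qⁿ x = begin
    q · x            ≡⟨ cong (q ·_) (*-identityˡ x) ⟨
    q · (1# * x)     ≡⟨ ×-assoc-* q 1# x ⟨
    (q · 1#) * x     ≡⟨ cong (_* x) (^≡0⇒≡0 n (begin
      (q · 1#) ^ n     ≡⟨ ·1-^ q n ⟨
      (q ℕ.^ n) · 1#   ≡⟨ cong (_· 1#) size≡qⁿ ⟨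
      size · 1#        ≡⟨ size·≡0 1# ⟩
      0#               ∎)) ⟩
    0# * x           ≡⟨ zeroˡ x ⟩
    0#               ∎
    where open ≡-Reasoning

module AdditiveSubgroups (K : FiniteField) {q : ℕ} (q-prime : Prime q) (char-q : FieldTheory.HasCharacteristic K q) where
  open FieldTheory K

  private instance
    q-nonZero : ℕ.NonZero q
    q-nonZero = prime⇒nonZero q-prime

  private
    1<q : 1 < q
    1<q = ℕ.nonTrivial⇒n>1 q {{prime⇒nonTrivial q-prime}}

    q-1≢0 : ℕ.NonZero (q ℕ.∸ 1)
    q-1≢0 = ℕ.>-nonZero (ℕ.∸-monoˡ-< 1<q (s≤s z≤n))

  -- Closure under negation follows, since - x = (q ∸ 1) · x (see -‿≡·).
  record IsAddSubgroup (P : F → Bool) : Set where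
    field
      0∈ : 0# ∈ P
      +∈ : ∀ {x y} → x ∈ P → y ∈ P → (x + y) ∈ P

  ·0≡0 : ∀ k → k · 0# ≡ 0#
  ·0≡0 zero = refl
  ·0≡0 (suc k) = trans (+-identityˡ (k · 0#)) (·0≡0 k)

  -‿≡· : ∀ x → - x ≡ (q ℕ.∸ 1) · x
  -‿≡· x = begin
    - x                   ≡⟨ +-identityˡ (- x) ⟨
    0# - x                ≡⟨ cong (_- x) (trans (cong (_· x) (ℕ.suc-pred q)) (char-q x)) ⟨
    suc m · x - x         ≡⟨ solve 2 (λ x a → (x :+ a) :- x := a) refl x (m · x) ⟩
    m · x                 ∎
    where
      open ≡-Reasoning
      m = q ℕ.∸ 1

  multiple-of-q : ∀ a x → (a ℕ.* q) · x ≡ 0#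
  multiple-of-q a x = trans (sym (×-assocˡ x a q)) (trans (cong (a ·_) (char-q x)) (·0≡0 a))

  module SubgroupProperties {P : F → Bool} (P-sub : IsAddSubgroup P) where
    open IsAddSubgroup P-sub public

    ·∈ : ∀ k {x} → x ∈ P → (k · x) ∈ P
    ·∈ zero x∈P = 0∈
    ·∈ (suc k) x∈P = +∈ x∈P (·∈ k x∈P)

    -∈ : ∀ {x} → x ∈ P → (- x) ∈ P
    -∈ {x} x∈P = subst (_∈ P) (sym (-‿≡· x)) (·∈ (q ℕ.∸ 1) x∈P)

    -‿∈ : ∀ {x y} → x ∈ P → y ∈ P → (x - y) ∈ P
    -‿∈ x∈P y∈P = +∈ x∈P (-∈ y∈P)

    +-invariant : ∀ {t} x → t ∈ P → P (x + t) ≡ P x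
    +-invariant {t} x t∈P = ⇔→≡ {z = true} (mk⇔
      (λ x+t∈P → subst (_∈ P) (solve 2 (λ x t → x :+ t :- t := x) refl x t) (-‿∈ x+t∈P t∈P))
      (λ x∈P → +∈ x∈P t∈P))

    -‿invariant : ∀ {t} x → t ∈ P → P (x - t) ≡ P x
    -‿invariant x t∈P = +-invariant x (-∈ t∈P)

    member-‿≡ : ∀ {u} w → u ∈ P → P (u - w) ≡ P w
    member-‿≡ {u} w u∈P = ⇔→≡ {z = true} (mk⇔
      (λ u-w∈P → subst (_∈ P) (solve 2 (λ u w → u :- (u :- w) := w) refl u w) (-‿∈ u∈P u-w∈P))
      (λ w∈P → -‿∈ u∈P w∈P))

    ·∈⁻¹ : ∀ j {x} → 0 < j → j < q → (j · x) ∈ P → x ∈ P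
    ·∈⁻¹ j {x} 0<j j<q jx∈P with coprime-Bézout (prime⇒coprime q-prime {{ℕ.>-nonZero 0<j}} j<q)
    ... | Bézout.+- a b 1+bj≡aq = subst (_∈ P) x≡-[bj·x] (-∈ bj·x∈P)
      where
        bj·x∈P : ((b ℕ.* j) · x) ∈ P
        bj·x∈P = subst (_∈ P) (×-assocˡ x b j) (·∈ b jx∈P)
        x≡-[bj·x] : - ((b ℕ.* j) · x) ≡ x
        x≡-[bj·x] = begin
          - c                  ≡⟨ +-identityˡ (- c) ⟨
          0# - c               ≡⟨ cong (_- c) (trans (cong (_· x) 1+bj≡aq) (multiple-of-q a x)) ⟨
          (x + c) - c          ≡⟨ solve 2 (λ x c → (x :+ c) :- c := x) refl x c ⟩
          x                    ∎
          where
            open ≡-Reasoning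
            c = (b ℕ.* j) · x
    ... | Bézout.-+ a b 1+aq≡bj = subst (_∈ P) bj·x≡x (subst (_∈ P) (×-assocˡ x b j) (·∈ b jx∈P))
      where
        bj·x≡x : (b ℕ.* j) · x ≡ x
        bj·x≡x = begin
          (b ℕ.* j) · x        ≡⟨ cong (_· x) 1+aq≡bj ⟨
          x + (a ℕ.* q) · x    ≡⟨ cong (x +_) (multiple-of-q a x) ⟩
          x + 0#               ≡⟨ +-identityʳ x ⟩
          x                    ∎
          where open ≡-Reasoning

  zero-subgroup : IsAddSubgroup (λ y → does (y ≟ 0#))
  zero-subgroup = record
    { 0∈ = dec-true (0# ≟ 0#) refl
    ; +∈ = λ {x} {y} x≡0 y≡0 → dec-true ((x + y) ≟ 0#)
        (trans (cong₂ _+_ (does⇒ (x ≟ 0#) x≡0) (does⇒ (y ≟ 0#) y≡0)) (+-identityʳ 0#)) }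

  2·1≢0 : 2 < q → 2 · 1# ≢ 0#
  2·1≢0 2<q 2·1≡0 = 1≢0 (does⇒ (1# ≟ 0#) (·∈⁻¹ 2 (s≤s z≤n) 2<q (dec-true ((2 · 1#) ≟ 0#) 2·1≡0)))
    where open SubgroupProperties zero-subgroup

  square-outside : 2 < q → ∀ {P} → IsAddSubgroup P → ∀ {u} → P u ≡ false → ∃[ s ] P (s * s) ≡ false
  square-outside 2<q {P} P-sub {u} u∉P = pick (P (a * a)) (P (c * c)) refl refl
    where
      open SubgroupProperties P-sub
      h = proj₁ (inverse (2 · 1#) (2·1≢0 2<q))
      a = (u + 1#) * h
      c = (u - 1#) * h
      difference : a * a - c * c ≡ u
      difference = begin
        a * a - c * c                  ≡⟨ difference-of-squares u 1# h ⟩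
        u * 1# * (h + h) * (h + h)     ≡⟨ cong (λ t → u * 1# * t * t) h+h≡1 ⟩
        u * 1# * 1# * 1#               ≡⟨ trans (*-identityʳ _) (trans (*-identityʳ _) (*-identityʳ u)) ⟩
        u                              ∎
        where
          open ≡-Reasoning
          difference-of-squares : ∀ u o h → (u + o) * h * ((u + o) * h) - (u - o) * h * ((u - o) * h) ≡ u * o * (h + h) * (h + h)
          difference-of-squares = solve 3 (λ u o h → (u :+ o) :* h :* ((u :+ o) :* h) :- (u :- o) :* h :* ((u :- o) :* h)
                                                     := u :* o :* (h :+ h) :* (h :+ h)) refl
          h+h≡1 : h + h ≡ 1#
          h+h≡1 = trans (cong₂ _+_ (sym (*-identityˡ h)) (trans (sym (*-identityˡ h)) (cong (_* h) (sym (+-identityʳ 1#)))))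
                    (trans (sym (distribʳ h 1# (1# + 0#))) (proj₂ (inverse (2 · 1#) (2·1≢0 2<q))))
      pick : ∀ ba bc → P (a * a) ≡ ba → P (c * c) ≡ bc → ∃[ s ] P (s * s) ≡ false
      pick false _ a²∉P _ = a , a²∉P
      pick true false _ c²∉P = c , c²∉P
      pick true true a²∈P c²∈P = ⊥-elim (∈⇒∉⇒⊥ {P} (subst (_∈ P) difference (-‿∈ a²∈P c²∈P)) u∉P)

  scaled-subgroup : ∀ {P} → IsAddSubgroup P → ∀ a → IsAddSubgroup (λ y → P (a * y))
  scaled-subgroup {P} P-sub a = record
    { 0∈ = subst (_∈ P) (sym (zeroʳ a)) 0∈
    ; +∈ = λ {x} {y} ax∈P ay∈P → subst (_∈ P) (sym (distribˡ a x y)) (+∈ ax∈P ay∈P) }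
    where open IsAddSubgroup P-sub

  module Fin-q = Counting (↔-id (Fin q))

  extend : (F → Bool) → F → F → Bool
  extend Y x₀ y = Fin-q.anyᵇ (λ k → Y (y - toℕ k · x₀))

  ∑-translates : ∀ Z x₀ → ∑ (λ y → Fin-q.∑ (λ k → 𝟙 (Z (y - toℕ k · x₀)))) ≡ q ℕ.* # Z
  ∑-translates Z x₀ = begin
    ∑ (λ y → Fin-q.∑ (λ k → 𝟙 (Z (y - toℕ k · x₀))))   ≡⟨ ∑-swap-sum {q} (λ y k → 𝟙 (Z (y - toℕ k · x₀))) ⟩
    Fin-q.∑ (λ k → # (λ y → Z (y - toℕ k · x₀)))          ≡⟨ Fin-q.∑-cong (λ k → #-translate Z (- (toℕ k · x₀))) ⟩
    Fin-q.∑ (λ _ → # Z)                                   ≡⟨ Fin-q.∑-const (# Z) ⟩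
    q ℕ.* # Z                                             ∎
    where open ≡-Reasoning

  ·-mod-q : ∀ m x → ∃[ k ] m · x ≡ toℕ k · x
  ·-mod-q m x with m divMod q
  ... | result quotient r m≡r+quotient*q = r , (begin
    m · x                                     ≡⟨ cong (_· x) m≡r+quotient*q ⟩
    (toℕ r ℕ.+ quotient ℕ.* q) · x            ≡⟨ ×-homo-+ x (toℕ r) (quotient ℕ.* q) ⟩
    toℕ r · x + (quotient ℕ.* q) · x          ≡⟨ cong (toℕ r · x +_) (multiple-of-q quotient x) ⟩
    toℕ r · x + 0#                            ≡⟨ +-identityʳ _ ⟩
    toℕ r · x                                 ∎)
    where open ≡-Reasoning

  module Extension {Y : F → Bool} (Y-sub : IsAddSubgroup Y) {x₀ : F} (x₀∉Y : Y x₀ ≡ false) where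
    open SubgroupProperties Y-sub

    private
      ordered-unique : ∀ y {a b} → (y - a · x₀) ∈ Y → (y - b · x₀) ∈ Y → a < b → b < q → ⊥
      ordered-unique y {a} {b} a∈ b∈ a<b b<q = ∈⇒∉⇒⊥ {Y} (·∈⁻¹ d (ℕ.m<n⇒0<n∸m a<b) d<q (subst (_∈ Y) difference (-‿∈ a∈ b∈))) x₀∉Y
        where
          d = b ℕ.∸ a
          d<q : d < q
          d<q = ℕ.≤-<-trans (ℕ.m∸n≤m b a) b<q
          difference : (y - a · x₀) - (y - b · x₀) ≡ d · x₀
          difference = begin
            (y - a · x₀) - (y - b · x₀)
              ≡⟨ cong (λ m → (y - a · x₀) - (y - m · x₀)) (ℕ.m+[n∸m]≡n (ℕ.<⇒≤ a<b)) ⟨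
            (y - a · x₀) - (y - (a ℕ.+ d) · x₀)
              ≡⟨ cong (λ z → (y - a · x₀) - (y - z)) (×-homo-+ x₀ a d) ⟩
            (y - a · x₀) - (y - (a · x₀ + d · x₀))
              ≡⟨ solve 3 (λ y u v → (y :- u) :- (y :- (u :+ v)) := v) refl y (a · x₀) (d · x₀) ⟩
            d · x₀ ∎
            where open ≡-Reasoning

    unique : ∀ y {k₁ k₂ : Fin q} → (y - toℕ k₁ · x₀) ∈ Y → (y - toℕ k₂ · x₀) ∈ Y → k₁ ≡ k₂
    unique y {k₁} {k₂} k₁∈ k₂∈ with ℕ.<-cmp (toℕ k₁) (toℕ k₂)
    ... | tri< k₁<k₂ _ _ = ⊥-elim (ordered-unique y k₁∈ k₂∈ k₁<k₂ (Fin.toℕ<n k₂))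
    ... | tri≈ _ k₁≡k₂ _ = Fin.toℕ-injective k₁≡k₂
    ... | tri> _ _ k₂<k₁ = ⊥-elim (ordered-unique y k₂∈ k₁∈ k₂<k₁ (Fin.toℕ<n k₁))

    #extend : # (extend Y x₀) ≡ q ℕ.* # Y
    #extend = trans (∑-cong (λ y → Fin-q.𝟙-anyᵇ _ (unique y))) (∑-translates Y x₀)

    extend-subgroup : IsAddSubgroup (extend Y x₀)
    extend-subgroup = record { 0∈ = extend-0∈ ; +∈ = extend-+∈ }
      where
        extend-0∈ : 0# ∈ extend Y x₀
        extend-0∈ with ·-mod-q 0 x₀
        ... | k , 0≡k·x₀ = Fin-q.anyᵇ-intro k (subst (λ z → (0# - z) ∈ Y) 0≡k·x₀ (-‿∈ 0∈ 0∈))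
        extend-+∈ : ∀ {y₁ y₂} → y₁ ∈ extend Y x₀ → y₂ ∈ extend Y x₀ → (y₁ + y₂) ∈ extend Y x₀
        extend-+∈ {y₁} {y₂} y₁∈ y₂∈ with Fin-q.anyᵇ-elim _ y₁∈ | Fin-q.anyᵇ-elim _ y₂∈
        ... | k₁ , k₁∈ | k₂ , k₂∈ with ·-mod-q (toℕ k₁ ℕ.+ toℕ k₂) x₀
        ...   | k , k₁+k₂≡k = Fin-q.anyᵇ-intro k (subst (_∈ Y) regroup (+∈ k₁∈ k₂∈))
          where
            open ≡-Reasoning
            regroup : (y₁ - toℕ k₁ · x₀) + (y₂ - toℕ k₂ · x₀) ≡ (y₁ + y₂) - toℕ k · x₀
            regroup = begin
              (y₁ - toℕ k₁ · x₀) + (y₂ - toℕ k₂ · x₀)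
                ≡⟨ solve 4 (λ y₁ y₂ u v → (y₁ :- u) :+ (y₂ :- v) := (y₁ :+ y₂) :- (u :+ v)) refl y₁ y₂ _ _ ⟩
              (y₁ + y₂) - (toℕ k₁ · x₀ + toℕ k₂ · x₀)
                ≡⟨ cong (λ z → (y₁ + y₂) - z) (trans (sym (×-homo-+ x₀ (toℕ k₁) (toℕ k₂))) k₁+k₂≡k) ⟩
              (y₁ + y₂) - toℕ k · x₀ ∎

    extend-covers : q ℕ.* # Y ≡ size → ∀ y → y ∈ extend Y x₀
    extend-covers q#Y≡size = ⊆∧#≡⇒≡ (λ _ → refl) (trans #extend (trans q#Y≡size (sym #-all)))

  subgroup-of-size : ∀ {n} → size ≡ q ℕ.^ n → ∀ j → j ≤ n → ∃[ S ] IsAddSubgroup S × # S ≡ q ℕ.^ j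
  subgroup-of-size _ zero _ = (λ y → does (y ≟ 0#)) , zero-subgroup , #-singleton 0#
  subgroup-of-size {n} size≡qⁿ (suc j) j<n with subgroup-of-size size≡qⁿ j (ℕ.<⇒≤ j<n)
  ... | S , S-sub , #S≡qʲ with #<n⇒nonmember S (subst₂ _<_ (sym #S≡qʲ) (sym size≡qⁿ) (ℕ.^-monoʳ-< q 1<q j<n))
  ...   | x₀ , x₀∉S = extend S x₀ , extend-subgroup , trans #extend (cong (q ℕ.*_) #S≡qʲ)
    where open Extension S-sub x₀∉S

  index-q-subgroup : ∀ {n} → 1 ≤ n → size ≡ q ℕ.^ n → ∃[ H ] IsAddSubgroup H × q ℕ.* # H ≡ size
  index-q-subgroup {n} 1≤n size≡qⁿ with subgroup-of-size size≡qⁿ (n ℕ.∸ 1) (ℕ.m∸n≤m n 1)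
  ... | H , H-sub , #H≡qⁿ⁻¹ = H , H-sub , (begin
    q ℕ.* # H              ≡⟨ cong (q ℕ.*_) #H≡qⁿ⁻¹ ⟩
    q ℕ.^ suc (n ℕ.∸ 1)    ≡⟨ cong (q ℕ.^_) (ℕ.m+[n∸m]≡n 1≤n) ⟩
    q ℕ.^ n                ≡⟨ size≡qⁿ ⟨
    size                   ∎)
    where open ≡-Reasoning

  ∩-has-index-q : ∀ {X Y} → IsAddSubgroup X → IsAddSubgroup Y → q ℕ.* # Y ≡ size →
            ∀ {x₀} → x₀ ∈ X → Y x₀ ≡ false → q ℕ.* # (λ y → X y ∧ Y y) ≡ # X
  ∩-has-index-q {X} {Y} X-sub Y-sub q#Y≡size {x₀} x₀∈X x₀∉Y = sym (trans (∑-cong pointwise) (∑-translates (λ y → X y ∧ Y y) x₀))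
    where
      open Extension Y-sub x₀∉Y
      module X = SubgroupProperties X-sub
      pointwise : ∀ y → 𝟙 (X y) ≡ Fin-q.∑ (λ k → 𝟙 (X (y - toℕ k · x₀) ∧ Y (y - toℕ k · x₀)))
      pointwise y = begin
        𝟙 (X y)
          ≡⟨ ℕ.*-identityʳ (𝟙 (X y)) ⟨
        𝟙 (X y) ℕ.* 𝟙 true
          ≡⟨ cong (λ b → 𝟙 (X y) ℕ.* 𝟙 b) (extend-covers q#Y≡size y) ⟨
        𝟙 (X y) ℕ.* 𝟙 (extend Y x₀ y)
          ≡⟨ cong (𝟙 (X y) ℕ.*_) (Fin-q.𝟙-anyᵇ _ (unique y)) ⟩
        𝟙 (X y) ℕ.* Fin-q.# (λ k → Y (y - toℕ k · x₀))
          ≡⟨ Fin-q.∑-*ˡ (𝟙 (X y)) (λ k → 𝟙 (Y (y - toℕ k · x₀))) ⟨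
        Fin-q.∑ (λ k → 𝟙 (X y) ℕ.* 𝟙 (Y (y - toℕ k · x₀)))
          ≡⟨ Fin-q.∑-cong (λ k → sym (𝟙-∧ (X y) _)) ⟩
        Fin-q.∑ (λ k → 𝟙 (X y ∧ Y (y - toℕ k · x₀)))
          ≡⟨ Fin-q.∑-cong (λ k → cong (λ b → 𝟙 (b ∧ _)) (X.-‿invariant y (X.·∈ (toℕ k) x₀∈X))) ⟨
        Fin-q.∑ (λ k → 𝟙 (X (y - toℕ k · x₀) ∧ Y (y - toℕ k · x₀))) ∎
        where open ≡-Reasoning

  module Annihilator {H : F → Bool} (H-sub : IsAddSubgroup H) (q#H≡size : q ℕ.* # H ≡ size) where
    private module H = SubgroupProperties H-sub

    private
      escapes : (F → Bool) → F → F → Bool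
      escapes X a y = X y ∧ not (H (a * y))

    -- (X ⟂) a holds iff a X ⊆ H: the annihilator of X for the pairing (a, y) ↦ [a y ∈ H].
    infix 10 _⟂
    _⟂ : (F → Bool) → F → Bool
    (X ⟂) a = not (anyᵇ (escapes X a))

    ⟂-intro : ∀ {X a} → (∀ {y} → y ∈ X → a * y ∈ H) → a ∈ X ⟂
    ⟂-intro {X} {a} aX⊆H = cong not (anyᵇ-none {escapes X a} no-escape)
      where
        no-escape : ∀ y → X y ∧ not (H (a * y)) ≡ false
        no-escape y with X y in Xy
        ... | false = refl
        ... | true rewrite aX⊆H Xy = refl

    ⟂-elim : ∀ {X a y} → a ∈ X ⟂ → y ∈ X → a * y ∈ H
    ⟂-elim {X} {a} {y} a∈X⟂ y∈X = not-injective
      (subst (λ b → b ∧ not (H (a * y)) ≡ false) y∈X (anyᵇ-false {escapes X a} (not-injective a∈X⟂) y))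

    ⟂-witness : ∀ {X a} → (X ⟂) a ≡ false → ∃[ y ] y ∈ X × H (a * y) ≡ false
    ⟂-witness {X} {a} a∉X⟂ = let y , y∈ = anyᵇ-elim (escapes X a) (not-injective a∉X⟂) in y , ∧-not≡true⇒ y∈

    ⟂-subgroup : ∀ X → IsAddSubgroup (X ⟂)
    ⟂-subgroup X = record
      { 0∈ = ⟂-intro {X} λ {y} _ → subst (_∈ H) (sym (zeroˡ y)) H.0∈
      ; +∈ = λ {a} {b} a∈ b∈ → ⟂-intro {X} λ {y} y∈X →
               subst (_∈ H) (sym (distribʳ y a b)) (H.+∈ (⟂-elim {X} a∈ y∈X) (⟂-elim {X} b∈ y∈X)) }

    private
      q≡1+[q-1] : q ≡ suc (q ℕ.∸ 1)
      q≡1+[q-1] = sym (ℕ.suc-pred q)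

      #H-scaled : ∀ {a} → a ≢ 0# → q ℕ.* # (λ y → H (a * y)) ≡ size
      #H-scaled a≢0 = trans (cong (q ℕ.*_) (#-scale H a≢0)) q#H≡size

    q·#∩-scaled : ∀ {X} → IsAddSubgroup X → ∀ a →
      q ℕ.* # (λ y → X y ∧ H (a * y)) ≡ # X ℕ.+ 𝟙 ((X ⟂) a) ℕ.* ((q ℕ.∸ 1) ℕ.* # X)
    q·#∩-scaled {X} X-sub a with (X ⟂) a in X⟂a
    ... | true = begin
      q ℕ.* # (λ y → X y ∧ H (a * y))       ≡⟨ cong (q ℕ.*_) (#-cong within) ⟩
      q ℕ.* # X                             ≡⟨ cong (ℕ._* # X) q≡1+[q-1] ⟩
      # X ℕ.+ (q ℕ.∸ 1) ℕ.* # X             ≡⟨ cong (# X ℕ.+_) (ℕ.*-identityˡ _) ⟨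
      # X ℕ.+ 1 ℕ.* ((q ℕ.∸ 1) ℕ.* # X)     ∎
      where
        open ≡-Reasoning
        within : ∀ y → X y ∧ H (a * y) ≡ X y
        within y with X y in Xy
        ... | true = ⟂-elim {X} X⟂a Xy
        ... | false = refl
    ... | false with ⟂-witness {X} X⟂a
    ...   | y₀ , y₀∈X , ay₀∉H = trans (∩-has-index-q X-sub (scaled-subgroup H-sub a) (#H-scaled a≢0) y₀∈X ay₀∉H) (sym (ℕ.+-identityʳ (# X)))
      where
        a≢0 : a ≢ 0#
        a≢0 refl = ∈⇒∉⇒⊥ {H} (subst (_∈ H) (sym (zeroˡ y₀)) H.0∈) ay₀∉H

    private
      q·∑rows : ∀ {X} → IsAddSubgroup X →
        q ℕ.* ∑ (λ a → # (λ y → X y ∧ H (a * y))) ≡ size ℕ.* # X ℕ.+ # (X ⟂) ℕ.* ((q ℕ.∸ 1) ℕ.* # X)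
      q·∑rows {X} X-sub = begin
        q ℕ.* ∑ (λ a → # (λ y → X y ∧ H (a * y)))
          ≡⟨ ∑-*ˡ q (λ a → # (λ y → X y ∧ H (a * y))) ⟨
        ∑ (λ a → q ℕ.* # (λ y → X y ∧ H (a * y)))
          ≡⟨ ∑-cong (q·#∩-scaled X-sub) ⟩
        ∑ (λ a → # X ℕ.+ 𝟙 ((X ⟂) a) ℕ.* ((q ℕ.∸ 1) ℕ.* # X))
          ≡⟨ ∑-+ (λ _ → # X) (λ a → 𝟙 ((X ⟂) a) ℕ.* ((q ℕ.∸ 1) ℕ.* # X)) ⟩
        ∑ (λ _ → # X) ℕ.+ ∑ (λ a → 𝟙 ((X ⟂) a) ℕ.* ((q ℕ.∸ 1) ℕ.* # X))
          ≡⟨ cong₂ ℕ._+_ (∑-const (# X)) (∑-*ʳ _ (𝟙 ∘ X ⟂)) ⟩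
        size ℕ.* # X ℕ.+ # (X ⟂) ℕ.* ((q ℕ.∸ 1) ℕ.* # X) ∎
        where open ≡-Reasoning

      q·#column : ∀ {X} → IsAddSubgroup X → ∀ y →
        q ℕ.* # (λ a → X y ∧ H (a * y)) ≡ 𝟙 (X y) ℕ.* size ℕ.+ (if does (y ≟ 0#) then (q ℕ.∸ 1) ℕ.* size else 0)
      q·#column {X} X-sub y with y ≟ 0#
      ... | yes refl rewrite IsAddSubgroup.0∈ X-sub | dec-true (0# ≟ 0#) refl = begin
        q ℕ.* # (λ a → H (a * 0#))
          ≡⟨ cong (q ℕ.*_) (trans (#-cong (λ a → trans (cong H (zeroʳ a)) H.0∈)) #-all) ⟩
        q ℕ.* size
          ≡⟨ cong (ℕ._* size) q≡1+[q-1] ⟩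
        size ℕ.+ (q ℕ.∸ 1) ℕ.* size
          ≡⟨ cong (ℕ._+ (q ℕ.∸ 1) ℕ.* size) (ℕ.+-identityʳ size) ⟨
        (size ℕ.+ 0) ℕ.+ (q ℕ.∸ 1) ℕ.* size ∎
        where open ≡-Reasoning
      ... | no y≢0 rewrite dec-false (y ≟ 0#) y≢0 with X y
      ...   | true = begin
        q ℕ.* # (λ a → H (a * y))           ≡⟨ cong (q ℕ.*_) (#-cong (λ a → cong H (*-comm a y))) ⟩
        q ℕ.* # (λ a → H (y * a))           ≡⟨ #H-scaled y≢0 ⟩
        size                                ≡⟨ trans (ℕ.+-identityʳ _) (ℕ.+-identityʳ _) ⟨
        (size ℕ.+ 0) ℕ.+ 0                  ∎
        where open ≡-Reasoning
      ...   | false = trans (cong (q ℕ.*_) #-none) (ℕ.*-zeroʳ q)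

      q·∑columns : ∀ {X} → IsAddSubgroup X →
        q ℕ.* ∑ (λ y → # (λ a → X y ∧ H (a * y))) ≡ # X ℕ.* size ℕ.+ (q ℕ.∸ 1) ℕ.* size
      q·∑columns {X} X-sub = begin
        q ℕ.* ∑ (λ y → # (λ a → X y ∧ H (a * y)))
          ≡⟨ ∑-*ˡ q (λ y → # (λ a → X y ∧ H (a * y))) ⟨
        ∑ (λ y → q ℕ.* # (λ a → X y ∧ H (a * y)))
          ≡⟨ ∑-cong (q·#column X-sub) ⟩
        ∑ (λ y → 𝟙 (X y) ℕ.* size ℕ.+ at0 y)
          ≡⟨ ∑-+ (λ y → 𝟙 (X y) ℕ.* size) at0 ⟩
        ∑ (λ y → 𝟙 (X y) ℕ.* size) ℕ.+ ∑ at0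
          ≡⟨ cong₂ ℕ._+_ (∑-*ʳ size (𝟙 ∘ X)) (∑-δ 0# (λ _ → (q ℕ.∸ 1) ℕ.* size)) ⟩
        # X ℕ.* size ℕ.+ (q ℕ.∸ 1) ℕ.* size ∎
        where
          open ≡-Reasoning
          at0 : F → ℕ
          at0 y = if does (y ≟ 0#) then (q ℕ.∸ 1) ℕ.* size else 0

    -- Double count the pairs (a, y) with y ∈ X and a * y ∈ H, by rows (q·#∩-scaled) and by columns (H has index q).
    #⟂*#≡size : ∀ {X} → IsAddSubgroup X → # (X ⟂) ℕ.* # X ≡ size
    #⟂*#≡size {X} X-sub = ℕ.*-cancelˡ-≡ _ _ (q ℕ.∸ 1) {{q-1≢0}} (ℕ.+-cancelˡ-≡ (size ℕ.* # X) _ _ (begin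
      size ℕ.* # X ℕ.+ (q ℕ.∸ 1) ℕ.* (# (X ⟂) ℕ.* # X)
        ≡⟨ cong (size ℕ.* # X ℕ.+_) (exchange (q ℕ.∸ 1) (# (X ⟂)) (# X)) ⟩
      size ℕ.* # X ℕ.+ # (X ⟂) ℕ.* ((q ℕ.∸ 1) ℕ.* # X)
        ≡⟨ q·∑rows X-sub ⟨
      q ℕ.* ∑ (λ a → # (λ y → X y ∧ H (a * y)))
        ≡⟨ cong (q ℕ.*_) (∑-swap (λ a y → 𝟙 (X y ∧ H (a * y)))) ⟩
      q ℕ.* ∑ (λ y → # (λ a → X y ∧ H (a * y)))
        ≡⟨ q·∑columns X-sub ⟩
      # X ℕ.* size ℕ.+ (q ℕ.∸ 1) ℕ.* size
        ≡⟨ cong (ℕ._+ (q ℕ.∸ 1) ℕ.* size) (ℕ.*-comm (# X) size) ⟩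
      size ℕ.* # X ℕ.+ (q ℕ.∸ 1) ℕ.* size ∎))
      where
        open ≡-Reasoning
        exchange : ∀ a b c → a ℕ.* (b ℕ.* c) ≡ b ℕ.* (a ℕ.* c)
        exchange = solve-∀

    ⊆⟂⟂ : ∀ {X x} → x ∈ X → x ∈ X ⟂ ⟂
    ⊆⟂⟂ {X} {x} x∈X = ⟂-intro {X ⟂} λ {a} a∈X⟂ → subst (_∈ H) (*-comm a x) (⟂-elim {X} a∈X⟂ x∈X)

    1≤#⟂ : ∀ X → 1 ≤ # (X ⟂)
    1≤#⟂ X = member⇒1≤# {X ⟂} 0# (IsAddSubgroup.0∈ (⟂-subgroup X))

    ⟂⟂ : ∀ {X} → IsAddSubgroup X → ∀ x → (X ⟂ ⟂) x ≡ X x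
    ⟂⟂ {X} X-sub x = sym (⊆∧#≡⇒≡ (⊆⟂⟂ {X}) (sym #⟂⟂≡#X) x)
      where
        #⟂⟂≡#X : # (X ⟂ ⟂) ≡ # X
        #⟂⟂≡#X = ℕ.*-cancelʳ-≡ _ _ (# (X ⟂)) {{ℕ.>-nonZero (1≤#⟂ X)}}
          (trans (#⟂*#≡size (⟂-subgroup X)) (trans (sym (#⟂*#≡size X-sub)) (ℕ.*-comm (# (X ⟂)) (# X))))

    q≤#⟂ : ∀ {X} → IsAddSubgroup X → ∀ {x} → X x ≡ false → q ≤ # (X ⟂)
    q≤#⟂ {X} X-sub {x} x∉X with 1≤#⇒member _ (ℕ.+-cancelˡ-≤ 1 1 _ (ℕ.≤-trans 2≤#⟂ (#≤1+#-without (X ⟂) 0#)))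
      where
        2≤#⟂ : 2 ≤ # (X ⟂)
        2≤#⟂ = ℕ.≰⇒> λ #⟂≤1 → ℕ.<⇒≱ (nonmember⇒#<n {X} x x∉X) (begin
          size                ≡⟨ #⟂*#≡size X-sub ⟨
          # (X ⟂) ℕ.* # X     ≤⟨ ℕ.*-monoˡ-≤ (# X) #⟂≤1 ⟩
          1 ℕ.* # X           ≡⟨ ℕ.*-identityˡ (# X) ⟩
          # X                 ∎)
          where open ℕ.≤-Reasoning
    ... | α , α∈ with ∧-not≡true⇒ α∈
    ...   | α∈X⟂ , α≢0 = begin
      q                                    ≡⟨ ℕ.*-identityʳ q ⟨
      q ℕ.* 1                              ≡⟨ cong (q ℕ.*_) (#-singleton 0#) ⟨
      q ℕ.* # (λ y → does (y ≟ 0#))        ≡⟨ #extend ⟨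
      # (extend (λ y → does (y ≟ 0#)) α)   ≤⟨ #-mono {extend (λ y → does (y ≟ 0#)) α} {X ⟂} ⊆X⟂ ⟩
      # (X ⟂)                              ∎
      where
        open ℕ.≤-Reasoning
        open Extension zero-subgroup α≢0
        ⊆X⟂ : ∀ {y} → y ∈ extend (λ y → does (y ≟ 0#)) α → y ∈ X ⟂
        ⊆X⟂ {y} y∈ with Fin-q.anyᵇ-elim _ y∈
        ... | k , y-kα∈0 = subst (_∈ X ⟂) (sym y≡kα) (SubgroupProperties.·∈ (⟂-subgroup X) (toℕ k) α∈X⟂)
          where
            y≡kα : y ≡ toℕ k · α
            y≡kα = trans (solve 2 (λ y u → y := (y :- u) :+ u) refl y (toℕ k · α))
                     (trans (cong (_+ toℕ k · α) (does⇒ ((y - toℕ k · α) ≟ 0#) y-kα∈0)) (+-identityˡ (toℕ k · α)))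

    module ProductBound {V W : F → Bool} (V-sub : IsAddSubgroup V) (W-sub : IsAddSubgroup W) (#W≡#V : # W ≡ # V) where
      private
        v M R : ℕ
        v = # V
        M = # (V ⟂)
        R = # (W ⟂)
        q-1 = q ℕ.∸ 1

      products-in-V : ℕ
      products-in-V = ∑[ h ∈ W ] # (λ w → W w ∧ V (h * w))

      private
        -- T counts the triples (h, w, α) ∈ W × W × V ⟂ with h w α ∈ H; summing over α first
        -- brings in products-in-V (as V ⟂ ⟂ = V), summing over w first brings in W ⟂.
        T : ℕ
        T = ∑[ h ∈ W ] ∑[ w ∈ W ] # (λ α → (V ⟂) α ∧ H (h * w * α))

        q·T-by-products : q ℕ.* T ≡ v ℕ.* (v ℕ.* M) ℕ.+ products-in-V ℕ.* (q-1 ℕ.* M)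
        q·T-by-products = begin
          q ℕ.* T
            ≡⟨ ∑∈-*ˡ q W (λ h → ∑[ w ∈ W ] # (λ α → (V ⟂) α ∧ H (h * w * α))) ⟩
          ∑[ h ∈ W ] (q ℕ.* ∑[ w ∈ W ] # (λ α → (V ⟂) α ∧ H (h * w * α)))
            ≡⟨ ∑∈-cong W (λ {h} _ → ∑∈-*ˡ q W (λ w → # (λ α → (V ⟂) α ∧ H (h * w * α)))) ⟩
          ∑[ h ∈ W ] ∑[ w ∈ W ] (q ℕ.* # (λ α → (V ⟂) α ∧ H (h * w * α)))
            ≡⟨ ∑∈-cong W (λ {h} _ → ∑∈-cong W (λ {w} _ → q·#∩V⟂ (h * w))) ⟩
          ∑[ h ∈ W ] ∑[ w ∈ W ] (M ℕ.+ 𝟙 (V (h * w)) ℕ.* (q-1 ℕ.* M))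
            ≡⟨ ∑∈-cong W (λ {h} _ → ∑∈-affine W (λ w → 𝟙 (V (h * w))) M (q-1 ℕ.* M)) ⟩
          ∑[ h ∈ W ] (# W ℕ.* M ℕ.+ ∑[ w ∈ W ] 𝟙 (V (h * w)) ℕ.* (q-1 ℕ.* M))
            ≡⟨ ∑∈-cong W (λ {h} _ → cong₂ (λ a b → a ℕ.* M ℕ.+ b ℕ.* (q-1 ℕ.* M)) #W≡#V (∑∈-𝟙 W (λ w → V (h * w)))) ⟩
          ∑[ h ∈ W ] (v ℕ.* M ℕ.+ # (λ w → W w ∧ V (h * w)) ℕ.* (q-1 ℕ.* M))
            ≡⟨ ∑∈-affine W (λ h → # (λ w → W w ∧ V (h * w))) (v ℕ.* M) (q-1 ℕ.* M) ⟩
          # W ℕ.* (v ℕ.* M) ℕ.+ products-in-V ℕ.* (q-1 ℕ.* M)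
            ≡⟨ cong (λ a → a ℕ.* (v ℕ.* M) ℕ.+ products-in-V ℕ.* (q-1 ℕ.* M)) #W≡#V ⟩
          v ℕ.* (v ℕ.* M) ℕ.+ products-in-V ℕ.* (q-1 ℕ.* M) ∎
          where
            open ≡-Reasoning
            q·#∩V⟂ : ∀ x → q ℕ.* # (λ α → (V ⟂) α ∧ H (x * α)) ≡ M ℕ.+ 𝟙 (V x) ℕ.* (q-1 ℕ.* M)
            q·#∩V⟂ x = trans (q·#∩-scaled (⟂-subgroup V) x) (cong (λ b → M ℕ.+ 𝟙 b ℕ.* (q-1 ℕ.* M)) (⟂⟂ V-sub x))

        k : F → ℕ
        k α = # (λ h → W h ∧ (W ⟂) (α * h))

        G : F → ℕ
        G α = ∑[ h ∈ W ] # (λ w → W w ∧ H (α * h * w))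

        T≡∑G : T ≡ ∑[ α ∈ V ⟂ ] G α
        T≡∑G = begin
          ∑[ h ∈ W ] ∑[ w ∈ W ] # (λ α → (V ⟂) α ∧ H (h * w * α))
            ≡⟨ ∑∈-cong W (λ {h} _ → ∑∈-cong W (λ {w} _ → sym (∑∈-𝟙 (V ⟂) (λ α → H (h * w * α))))) ⟩
          ∑[ h ∈ W ] ∑[ w ∈ W ] ∑[ α ∈ V ⟂ ] 𝟙 (H (h * w * α))
            ≡⟨ ∑∈-cong W (λ {h} _ → ∑∈-swap W (V ⟂) (λ w α → 𝟙 (H (h * w * α)))) ⟩
          ∑[ h ∈ W ] ∑[ α ∈ V ⟂ ] ∑[ w ∈ W ] 𝟙 (H (h * w * α))
            ≡⟨ ∑∈-swap W (V ⟂) (λ h α → ∑[ w ∈ W ] 𝟙 (H (h * w * α))) ⟩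
          ∑[ α ∈ V ⟂ ] ∑[ h ∈ W ] ∑[ w ∈ W ] 𝟙 (H (h * w * α))
            ≡⟨ ∑∈-cong (V ⟂) (λ {α} _ → ∑∈-cong W (λ {h} _ → ∑∈-cong W (λ {w} _ →
                                                                          cong (𝟙 ∘ H) (solve 3 (λ h w α → h :* w :* α := α :* h :* w) refl h w α)))) ⟩
          ∑[ α ∈ V ⟂ ] ∑[ h ∈ W ] ∑[ w ∈ W ] 𝟙 (H (α * h * w))
            ≡⟨ ∑∈-cong (V ⟂) (λ {α} _ → ∑∈-cong W (λ {h} _ → ∑∈-𝟙 W (λ w → H (α * h * w)))) ⟩
          ∑[ α ∈ V ⟂ ] G α ∎
          where open ≡-Reasoning

        q·G : ∀ α → q ℕ.* G α ≡ v ℕ.* v ℕ.+ k α ℕ.* (q-1 ℕ.* v)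
        q·G α = begin
          q ℕ.* G α
            ≡⟨ ∑∈-*ˡ q W (λ h → # (λ w → W w ∧ H (α * h * w))) ⟩
          ∑[ h ∈ W ] (q ℕ.* # (λ w → W w ∧ H (α * h * w)))
            ≡⟨ ∑∈-cong W (λ {h} _ → q·#∩-scaled W-sub (α * h)) ⟩
          ∑[ h ∈ W ] (# W ℕ.+ 𝟙 ((W ⟂) (α * h)) ℕ.* (q-1 ℕ.* # W))
            ≡⟨ ∑∈-affine W (λ h → 𝟙 ((W ⟂) (α * h))) (# W) (q-1 ℕ.* # W) ⟩
          # W ℕ.* # W ℕ.+ ∑[ h ∈ W ] 𝟙 ((W ⟂) (α * h)) ℕ.* (q-1 ℕ.* # W)
            ≡⟨ cong (λ a → # W ℕ.* # W ℕ.+ a ℕ.* (q-1 ℕ.* # W)) (∑∈-𝟙 W (λ h → (W ⟂) (α * h))) ⟩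
          # W ℕ.* # W ℕ.+ k α ℕ.* (q-1 ℕ.* # W)
            ≡⟨ cong (λ a → a ℕ.* a ℕ.+ k α ℕ.* (q-1 ℕ.* a)) #W≡#V ⟩
          v ℕ.* v ℕ.+ k α ℕ.* (q-1 ℕ.* v) ∎
          where open ≡-Reasoning

        q·T-by-annihilator : q ℕ.* T ≡ M ℕ.* (v ℕ.* v) ℕ.+ (∑[ α ∈ V ⟂ ] k α) ℕ.* (q-1 ℕ.* v)
        q·T-by-annihilator = begin
          q ℕ.* T                                            ≡⟨ cong (q ℕ.*_) T≡∑G ⟩
          q ℕ.* ∑[ α ∈ V ⟂ ] G α                             ≡⟨ ∑∈-*ˡ q (V ⟂) G ⟩
          ∑[ α ∈ V ⟂ ] (q ℕ.* G α)                           ≡⟨ ∑∈-cong (V ⟂) (λ {α} _ → q·G α) ⟩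
          ∑[ α ∈ V ⟂ ] (v ℕ.* v ℕ.+ k α ℕ.* (q-1 ℕ.* v))     ≡⟨ ∑∈-affine (V ⟂) k (v ℕ.* v) (q-1 ℕ.* v) ⟩
          M ℕ.* (v ℕ.* v) ℕ.+ (∑[ α ∈ V ⟂ ] k α) ℕ.* (q-1 ℕ.* v) ∎
          where open ≡-Reasoning

        products*M≡∑k*v : products-in-V ℕ.* M ≡ (∑[ α ∈ V ⟂ ] k α) ℕ.* v
        products*M≡∑k*v = ℕ.*-cancelˡ-≡ _ _ q-1 {{q-1≢0}} (begin
          q-1 ℕ.* (products-in-V ℕ.* M)
            ≡⟨ exchange q-1 products-in-V M ⟩
          products-in-V ℕ.* (q-1 ℕ.* M)
            ≡⟨ ℕ.+-cancelˡ-≡ (v ℕ.* (v ℕ.* M)) _ _ (begin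
            v ℕ.* (v ℕ.* M) ℕ.+ products-in-V ℕ.* (q-1 ℕ.* M)
              ≡⟨ q·T-by-products ⟨
            q ℕ.* T
              ≡⟨ q·T-by-annihilator ⟩
            M ℕ.* (v ℕ.* v) ℕ.+ (∑[ α ∈ V ⟂ ] k α) ℕ.* (q-1 ℕ.* v)
              ≡⟨ cong (ℕ._+ (∑[ α ∈ V ⟂ ] k α) ℕ.* (q-1 ℕ.* v)) (rotate M v) ⟩
            v ℕ.* (v ℕ.* M) ℕ.+ (∑[ α ∈ V ⟂ ] k α) ℕ.* (q-1 ℕ.* v) ∎) ⟩
          (∑[ α ∈ V ⟂ ] k α) ℕ.* (q-1 ℕ.* v)       ≡⟨ exchange q-1 (∑[ α ∈ V ⟂ ] k α) v ⟨
          q-1 ℕ.* ((∑[ α ∈ V ⟂ ] k α) ℕ.* v)       ∎)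
          where
            open ≡-Reasoning
            exchange : ∀ a b c → a ℕ.* (b ℕ.* c) ≡ b ℕ.* (a ℕ.* c)
            exchange = solve-∀
            rotate : ∀ m v → m ℕ.* (v ℕ.* v) ≡ v ℕ.* (v ℕ.* m)
            rotate = solve-∀

        k≤v : ∀ α → k α ≤ v
        k≤v α = subst (k α ≤_) #W≡#V (#-mono {λ h → W h ∧ (W ⟂) (α * h)} {W} (proj₁ ∘ ∧-true⇒))

        k≤R : ∀ {α} → α ≢ 0# → k α ≤ R
        k≤R {α} α≢0 = subst (k α ≤_) (#-scale (W ⟂) α≢0) (#-mono {λ h → W h ∧ (W ⟂) (α * h)} {λ h → (W ⟂) (α * h)} (proj₂ ∘ ∧-true⇒))

        ∑k+R≤v+M*R : (∑[ α ∈ V ⟂ ] k α) ℕ.+ R ≤ v ℕ.+ M ℕ.* R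
        ∑k+R≤v+M*R = subst₂ _≤_
          (trans (∑-+ (λ α → 𝟙 ((V ⟂) α) ℕ.* k α) (at0 R)) (cong ((∑[ α ∈ V ⟂ ] k α) ℕ.+_) (∑-δ 0# (λ _ → R))))
          (trans (∑-+ (at0 v) (λ α → 𝟙 ((V ⟂) α) ℕ.* R)) (cong₂ ℕ._+_ (∑-δ 0# (λ _ → v)) (∑-*ʳ R (𝟙 ∘ V ⟂))))
          (∑-mono pointwise)
          where
            at0 : ℕ → F → ℕ
            at0 c α = if does (α ≟ 0#) then c else 0
            pointwise : ∀ α → 𝟙 ((V ⟂) α) ℕ.* k α ℕ.+ (if does (α ≟ 0#) then R else 0)
                            ≤ (if does (α ≟ 0#) then v else 0) ℕ.+ 𝟙 ((V ⟂) α) ℕ.* R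
            pointwise α with α ≟ 0#
            ... | yes refl rewrite dec-true (0# ≟ 0#) refl | IsAddSubgroup.0∈ (⟂-subgroup V) =
              ℕ.+-mono-≤ (ℕ.≤-trans (ℕ.≤-reflexive (ℕ.*-identityˡ (k 0#))) (k≤v 0#)) (ℕ.≤-reflexive (sym (ℕ.*-identityˡ R)))
            ... | no α≢0 rewrite dec-false (α ≟ 0#) α≢0 =
              subst (_≤ 𝟙 ((V ⟂) α) ℕ.* R) (sym (ℕ.+-identityʳ _)) (ℕ.*-monoʳ-≤ (𝟙 ((V ⟂) α)) (k≤R α≢0))

      products-bound : size ℕ.* products-in-V ℕ.+ size ℕ.* v ≤ v ℕ.* v ℕ.* v ℕ.+ size ℕ.* size
      products-bound = begin
        size ℕ.* products-in-V ℕ.+ size ℕ.* v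
          ≡⟨ cong₂ (λ s t → s ℕ.* products-in-V ℕ.+ t ℕ.* v) M*v≡size R*v≡size ⟨
        M ℕ.* v ℕ.* products-in-V ℕ.+ R ℕ.* v ℕ.* v
          ≡⟨ regroupˡ M v products-in-V R ⟩
        (products-in-V ℕ.* M ℕ.+ R ℕ.* v) ℕ.* v
          ≡⟨ cong (λ a → (a ℕ.+ R ℕ.* v) ℕ.* v) products*M≡∑k*v ⟩
        ((∑[ α ∈ V ⟂ ] k α) ℕ.* v ℕ.+ R ℕ.* v) ℕ.* v
          ≡⟨ cong (ℕ._* v) (ℕ.*-distribʳ-+ v (∑[ α ∈ V ⟂ ] k α) R) ⟨
        ((∑[ α ∈ V ⟂ ] k α) ℕ.+ R) ℕ.* v ℕ.* v
          ≤⟨ ℕ.*-monoˡ-≤ v (ℕ.*-monoˡ-≤ v ∑k+R≤v+M*R) ⟩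
        (v ℕ.+ M ℕ.* R) ℕ.* v ℕ.* v
          ≡⟨ regroupʳ v M R ⟩
        v ℕ.* v ℕ.* v ℕ.+ M ℕ.* v ℕ.* (R ℕ.* v)
          ≡⟨ cong₂ (λ s t → v ℕ.* v ℕ.* v ℕ.+ s ℕ.* t) M*v≡size R*v≡size ⟩
        v ℕ.* v ℕ.* v ℕ.+ size ℕ.* size ∎
        where
          open ℕ.≤-Reasoning
          M*v≡size : M ℕ.* v ≡ size
          M*v≡size = #⟂*#≡size V-sub
          R*v≡size : R ℕ.* v ≡ size
          R*v≡size = trans (cong (R ℕ.*_) (sym #W≡#V)) (#⟂*#≡size W-sub)
          regroupˡ : ∀ M v P R → M ℕ.* v ℕ.* P ℕ.+ R ℕ.* v ℕ.* v ≡ (P ℕ.* M ℕ.+ R ℕ.* v) ℕ.* v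
          regroupˡ = solve-∀
          regroupʳ : ∀ v M R → (v ℕ.+ M ℕ.* R) ℕ.* v ℕ.* v ≡ v ℕ.* v ℕ.* v ℕ.+ M ℕ.* v ℕ.* (R ℕ.* v)
          regroupʳ = solve-∀

  module CommonNeighbours (2<q : 2 < q) {H : F → Bool} (H-sub : IsAddSubgroup H) (q#H≡size : q ℕ.* # H ≡ size)
    {V : F → Bool} (V-sub : IsAddSubgroup V) (b : F) (b≢0 : b ≢ 0#) (x y : F) (x≢y : x ≢ y) where

    open SubgroupProperties V-sub
    open Annihilator H-sub q#H≡size

    v : ℕ
    v = # V

    Q₁ Q₂ : F → F
    Q₁ z = Qb b x z
    Q₂ z = Qb b z y

    β c₀ : F
    β = b * (x - y)
    c₀ = x * x - y * y

    β≢0 : β ≢ 0#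
    β≢0 β≡0 = x≢y (begin
      x                ≡⟨ solve 2 (λ x y → x := (x :- y) :+ y) refl x y ⟩
      (x - y) + y      ≡⟨ cong (_+ y) (no-zero-divisors b≢0 β≡0) ⟩
      0# + y           ≡⟨ +-identityˡ y ⟩
      y                ∎)
      where open ≡-Reasoning

    Q₁-Q₂ : ∀ z → Q₁ z - Q₂ z ≡ β * z + c₀
    Q₁-Q₂ z = solve 4 (λ b x y z → (x :* x :+ b :* x :* z :+ z :* z) :- (z :* z :+ b :* z :* y :+ y :* y)
                                    := b :* (x :- y) :* z :+ (x :* x :- y :* y)) refl b x y z

    Z W : F → Bool
    Z z = V (Q₁ z - Q₂ z)
    W h = V (β * h)

    #W≡v : # W ≡ v
    #W≡v = #-scale V β≢0

    #Z≡v : # Z ≡ v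
    #Z≡v = trans (#-cong (cong V ∘ Q₁-Q₂)) (trans (#-scale (λ u → V (u + c₀)) β≢0) (#-translate V c₀))

    N : ℕ
    N = # (λ z → Z z ∧ V (Q₁ z))

    #common≡N : # (λ z → V (Q₁ z) ∧ V (Q₂ z)) ≡ N
    #common≡N = #-cong pointwise
      where
        pointwise : ∀ z → V (Q₁ z) ∧ V (Q₂ z) ≡ Z z ∧ V (Q₁ z)
        pointwise z with V (Q₁ z) in Q₁z∈V
        ... | true = trans (sym (member-‿≡ (Q₂ z) Q₁z∈V)) (sym (∧-identityʳ _))
        ... | false = sym (∧-zeroʳ (Z z))

    fibre : F → ℕ
    fibre t = ∑[ z ∈ Z ] 𝟙 (V (Q₁ z - t))

    fibre-member : ∀ {t} → t ∈ V → fibre t ≡ N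
    fibre-member t∈V = trans (∑∈-cong Z (λ {z} _ → cong 𝟙 (-‿invariant (Q₁ z) t∈V))) (∑∈-𝟙 Z (V ∘ Q₁))

    ∑fibre : ∑ fibre ≡ v ℕ.* v
    ∑fibre = begin
      ∑ fibre                                     ≡⟨ ∑-∑∈-swap Z (λ t z → 𝟙 (V (Q₁ z - t))) ⟩
      ∑[ z ∈ Z ] # (λ t → V (Q₁ z - t))           ≡⟨ ∑∈-cong Z (λ {z} _ → #-reflect V (Q₁ z)) ⟩
      ∑[ z ∈ Z ] v                                ≡⟨ ∑∈-const Z v ⟩
      # Z ℕ.* v                                   ≡⟨ cong (ℕ._* v) #Z≡v ⟩
      v ℕ.* v                                     ∎
      where open ≡-Reasoning

    S : ℕ
    S = ∑[ z ∈ Z ] ∑[ z′ ∈ Z ] 𝟙 (V (Q₁ z - Q₁ z′))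

    ∑fibre² : ∑ (λ t → fibre t ℕ.* fibre t) ≡ v ℕ.* S
    ∑fibre² = begin
      ∑ (λ t → fibre t ℕ.* fibre t)
        ≡⟨ ∑-cong (λ t → ∑∈-product Z Z (λ z → hit z t) (λ z′ → hit z′ t)) ⟩
      ∑ (λ t → ∑[ z ∈ Z ] ∑[ z′ ∈ Z ] (hit z t ℕ.* hit z′ t))
        ≡⟨ ∑-∑∈-swap Z (λ t z → ∑[ z′ ∈ Z ] (hit z t ℕ.* hit z′ t)) ⟩
      ∑[ z ∈ Z ] ∑ (λ t → ∑[ z′ ∈ Z ] (hit z t ℕ.* hit z′ t))
        ≡⟨ ∑∈-cong Z (λ {z} _ → ∑-∑∈-swap Z (λ t z′ → hit z t ℕ.* hit z′ t)) ⟩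
      ∑[ z ∈ Z ] ∑[ z′ ∈ Z ] ∑ (λ t → hit z t ℕ.* hit z′ t)
        ≡⟨ ∑∈-cong Z (λ {z} _ → ∑∈-cong Z (λ {z′} _ → pair-count (Q₁ z) (Q₁ z′))) ⟩
      ∑[ z ∈ Z ] ∑[ z′ ∈ Z ] (v ℕ.* 𝟙 (V (Q₁ z - Q₁ z′)))
        ≡⟨ ∑∈-cong Z (λ {z} _ → sym (∑∈-*ˡ v Z (λ z′ → 𝟙 (V (Q₁ z - Q₁ z′))))) ⟩
      ∑[ z ∈ Z ] (v ℕ.* ∑[ z′ ∈ Z ] 𝟙 (V (Q₁ z - Q₁ z′)))
        ≡⟨ ∑∈-*ˡ v Z (λ z → ∑[ z′ ∈ Z ] 𝟙 (V (Q₁ z - Q₁ z′))) ⟨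
      v ℕ.* S ∎
      where
        open ≡-Reasoning
        hit : F → F → ℕ
        hit z t = 𝟙 (V (Q₁ z - t))
        pair-count : ∀ a a′ → ∑ (λ t → 𝟙 (V (a - t)) ℕ.* 𝟙 (V (a′ - t))) ≡ v ℕ.* 𝟙 (V (a - a′))
        pair-count a a′ = begin
          ∑ (λ t → 𝟙 (V (a - t)) ℕ.* 𝟙 (V (a′ - t)))        ≡⟨ ∑-cong pointwise ⟩
          ∑ (λ t → 𝟙 (V (a - a′)) ℕ.* 𝟙 (V (a - t)))        ≡⟨ ∑-*ˡ (𝟙 (V (a - a′))) (λ t → 𝟙 (V (a - t))) ⟩
          𝟙 (V (a - a′)) ℕ.* # (λ t → V (a - t))            ≡⟨ cong (𝟙 (V (a - a′)) ℕ.*_) (#-reflect V a) ⟩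
          𝟙 (V (a - a′)) ℕ.* v                              ≡⟨ ℕ.*-comm (𝟙 (V (a - a′))) v ⟩
          v ℕ.* 𝟙 (V (a - a′))                              ∎
          where
            pointwise : ∀ t → 𝟙 (V (a - t)) ℕ.* 𝟙 (V (a′ - t)) ≡ 𝟙 (V (a - a′)) ℕ.* 𝟙 (V (a - t))
            pointwise t with V (a - t) in a-t∈V
            ... | false = sym (ℕ.*-zeroʳ (𝟙 (V (a - a′))))
            ... | true = begin
              1 ℕ.* 𝟙 (V (a′ - t))
                ≡⟨ ℕ.*-identityˡ _ ⟩
              𝟙 (V (a′ - t))
                ≡⟨ cong (𝟙 ∘ V) (solve 3 (λ a a′ t → a′ :- t := (a :- t) :- (a :- a′)) refl a a′ t) ⟩
              𝟙 (V ((a - t) - (a - a′)))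
                ≡⟨ cong 𝟙 (member-‿≡ (a - a′) a-t∈V) ⟩
              𝟙 (V (a - a′))
                ≡⟨ ℕ.*-identityʳ _ ⟨
              𝟙 (V (a - a′)) ℕ.* 1 ∎

    private
      E : F → F → F
      E z h = h * (z + z - h + b * x)

      Q₁-difference : ∀ z h → Q₁ z - Q₁ (z - h) ≡ E z h
      Q₁-difference z h = solve 4 (λ b x z h → (x :* x :+ b :* x :* z :+ z :* z) :- (x :* x :+ b :* x :* (z :- h) :+ (z :- h) :* (z :- h))
                                                 := h :* (z :+ z :- h :+ b :* x)) refl b x z h

      E-difference : ∀ z z₁ h → E z h - E z₁ h ≡ 2 · (h * (z - z₁))
      E-difference z z₁ h = trans (solve 5 (λ b x z z₁ h → h :* (z :+ z :- h :+ b :* x) :- h :* (z₁ :+ z₁ :- h :+ b :* x)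
                                                              := h :* (z :- z₁) :+ h :* (z :- z₁)) refl b x z z₁ h)
                                  (cong (h * (z - z₁) +_) (sym (+-identityʳ (h * (z - z₁)))))

      W-shift : ∀ {z} → z ∈ Z → ∀ h → Z (z - h) ≡ W h
      W-shift {z} z∈Z h = begin
        V (Q₁ (z - h) - Q₂ (z - h))
          ≡⟨ cong V (Q₁-Q₂ (z - h)) ⟩
        V (β * (z - h) + c₀)
          ≡⟨ cong V (solve 4 (λ β z h c → β :* (z :- h) :+ c := (β :* z :+ c) :- β :* h) refl β z h c₀) ⟩
        V ((β * z + c₀) - β * h)
          ≡⟨ member-‿≡ (β * h) (subst (_∈ V) (Q₁-Q₂ z) z∈Z) ⟩
        V (β * h) ∎
        where open ≡-Reasoning

      -- z ↦ z - z₁ for one solution z₁; E z h - E z₁ h = 2 h (z - z₁) and 2 is invertible mod q.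
      #Z∩E≤#W∩scaled : ∀ h → # (λ z → Z z ∧ V (E z h)) ≤ # (λ w → W w ∧ V (h * w))
      #Z∩E≤#W∩scaled h with 1 ℕ.≤? # (λ z → Z z ∧ V (E z h))
      ... | no 1≰# = ℕ.≤-trans (ℕ.≤-pred (ℕ.≰⇒> 1≰#)) z≤n
      ... | yes 1≤# with 1≤#⇒member _ 1≤#
      ...   | z₁ , z₁∈ = #-mono-translate {λ z → Z z ∧ V (E z h)} {λ w → W w ∧ V (h * w)} z₁ shift
        where
          shift : ∀ {z} → Z z ∧ V (E z h) ≡ true → W (z - z₁) ∧ V (h * (z - z₁)) ≡ true
          shift {z} z∈ with ∧-true⇒ z∈ | ∧-true⇒ z₁∈
          ... | z∈Z , Ez∈V | z₁∈Z , Ez₁∈V = ∧-true⇐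
            (subst (_∈ V) (solve 4 (λ β z z₁ c → (β :* z :+ c) :- (β :* z₁ :+ c) := β :* (z :- z₁)) refl β z z₁ c₀)
              (-‿∈ (subst (_∈ V) (Q₁-Q₂ z) z∈Z) (subst (_∈ V) (Q₁-Q₂ z₁) z₁∈Z)))
            (·∈⁻¹ 2 (s≤s z≤n) 2<q (subst (_∈ V) (E-difference z z₁ h) (-‿∈ Ez∈V Ez₁∈V)))

    open ProductBound V-sub (scaled-subgroup V-sub β) #W≡v

    S≤products : S ≤ products-in-V
    S≤products = begin
      S                                          ≡⟨ ∑∈-cong Z row ⟩
      ∑[ z ∈ Z ] ∑[ h ∈ W ] 𝟙 (V (E z h))        ≡⟨ ∑∈-swap Z W (λ z h → 𝟙 (V (E z h))) ⟩
      ∑[ h ∈ W ] ∑[ z ∈ Z ] 𝟙 (V (E z h))        ≡⟨ ∑∈-cong W (λ {h} _ → ∑∈-𝟙 Z (λ z → V (E z h))) ⟩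
      ∑[ h ∈ W ] # (λ z → Z z ∧ V (E z h))       ≤⟨ ∑∈-mono W (λ {h} _ → #Z∩E≤#W∩scaled h) ⟩
      products-in-V                              ∎
      where
        open ℕ.≤-Reasoning
        row : ∀ {z} → z ∈ Z → ∑[ z′ ∈ Z ] 𝟙 (V (Q₁ z - Q₁ z′)) ≡ ∑[ h ∈ W ] 𝟙 (V (E z h))
        row {z} z∈Z = trans (sym (∑-reindex (reflection z) (λ z′ → 𝟙 (Z z′) ℕ.* 𝟙 (V (Q₁ z - Q₁ z′)))))
          (∑-cong (λ h → cong₂ (λ a b → 𝟙 a ℕ.* 𝟙 (V b)) (W-shift z∈Z h) (Q₁-difference z h)))

    private
      c : ℕ
      c = # (not ∘ V)

      1≤v : 1 ≤ v
      1≤v = member⇒1≤# {V} 0# 0∈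

      c+v≡size : c ℕ.+ v ≡ size
      c+v≡size = trans (ℕ.+-comm c v) (#-complement V)

      split-at-V : ∀ (f : F → ℕ) k → (∀ {t} → t ∈ V → f t ≡ k) → ∑[ t ∈ not ∘ V ] f t ℕ.+ v ℕ.* k ≡ ∑ f
      split-at-V f k on-V = trans (ℕ.+-comm _ (v ℕ.* k))
        (trans (cong (ℕ._+ ∑[ t ∈ not ∘ V ] f t) (trans (sym (∑∈-const V k)) (sym (∑∈-cong V on-V)))) (sym (∑-split V f)))

      first-moment : ∑[ t ∈ not ∘ V ] fibre t ℕ.+ v ℕ.* N ≡ v ℕ.* v
      first-moment = trans (split-at-V fibre N fibre-member) ∑fibre

      second-moment : ∑[ t ∈ not ∘ V ] (fibre t ℕ.* fibre t) ℕ.+ v ℕ.* (N ℕ.* N) ≡ v ℕ.* S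
      second-moment = trans (split-at-V (λ t → fibre t ℕ.* fibre t) (N ℕ.* N) (λ t∈V → cong₂ ℕ._*_ (fibre-member t∈V) (fibre-member t∈V))) ∑fibre²

      fibre-bound : size ℕ.* S ℕ.+ size ℕ.* v ≤ v ℕ.* v ℕ.* v ℕ.+ size ℕ.* size
      fibre-bound = ℕ.≤-trans (ℕ.+-monoˡ-≤ (size ℕ.* v) (ℕ.*-monoʳ-≤ size S≤products)) products-bound

      2v≤c : ∀ {u} → V u ≡ false → 2 ℕ.* v ≤ c
      2v≤c u∉V = ℕ.+-cancelʳ-≤ v (2 ℕ.* v) c (begin
        2 ℕ.* v ℕ.+ v        ≡⟨ three-v v ⟩
        3 ℕ.* v              ≤⟨ ℕ.*-monoˡ-≤ v (ℕ.≤-trans 2<q (q≤#⟂ V-sub u∉V)) ⟩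
        # (V ⟂) ℕ.* v        ≡⟨ #⟂*#≡size V-sub ⟩
        size                 ≡⟨ c+v≡size ⟨
        c ℕ.+ v              ∎)
        where
          open ℕ.≤-Reasoning
          three-v : ∀ v → 2 ℕ.* v ℕ.+ v ≡ 3 ℕ.* v
          three-v = solve-∀

    3≤#common : ∀ {u} → V u ≡ false → size ℕ.* size ℕ.* size ≤ v ℕ.* v ℕ.* v ℕ.* v →
                3 ≤ # (λ z → V (Q₁ z) ∧ V (Q₂ z))
    3≤#common u∉V size³≤v⁴ =
      let d , v≡N+d , vd²≤cS = variance-bound {v} {N} {S} {c = c} 1≤v first-moment second-moment (cauchy-schwarz (𝟙 ∘ not ∘ V) fibre)
      in subst (3 ≤_) (sym #common≡N) (variance-bound⇒3≤N v≡N+d (sym c+v≡size) vd²≤cS fibre-bound size³≤v⁴ (2v≤c u∉V) 1≤v)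

module Diameter (K : FiniteField) {q n : ℕ} (q-prime : Prime q) (q≢2 : q ≢ 2) (2≤n : 2 ≤ n)
  (size≡qⁿ : FiniteField.size K ≡ q ℕ.^ n)
  {V : Pred (FiniteField.F K) 0ℓ} (V? : Decidable V) (V-subspace : FiniteField.IsSubspace K q V) where
  open FieldTheory K

  private
    1≤n : 1 ≤ n
    1≤n = ℕ.≤-trans (s≤s z≤n) 2≤n

    2<q : 2 < q
    2<q = ℕ.≤∧≢⇒< (ℕ.nonTrivial⇒n>1 q {{prime⇒nonTrivial q-prime}}) (q≢2 ∘ sym)

  open AdditiveSubgroups K q-prime (characteristic 1≤n size≡qⁿ)

  private
    H : F → Bool
    H = proj₁ (index-q-subgroup 1≤n size≡qⁿ)
    H-sub : IsAddSubgroup H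
    H-sub = proj₁ (proj₂ (index-q-subgroup 1≤n size≡qⁿ))
    q#H≡size : q ℕ.* # H ≡ size
    q#H≡size = proj₂ (proj₂ (index-q-subgroup 1≤n size≡qⁿ))

  Vᵇ : F → Bool
  Vᵇ u = does (V? u)

  Vᵇ-sub : IsAddSubgroup Vᵇ
  Vᵇ-sub = record
    { 0∈ = dec-true (V? 0#) (IsSubspace.zero∈ V-subspace)
    ; +∈ = λ {x} {y} x∈ y∈ → dec-true (V? (x + y)) (IsSubspace.+-closed V-subspace (does⇒ (V? x) x∈) (does⇒ (V? y) y∈)) }

  size³≤|V|⁴ : q ℕ.^ (3 ℕ.* n) ≤ card V? ℕ.^ 4 → size ℕ.* size ℕ.* size ≤ # Vᵇ ℕ.* # Vᵇ ℕ.* # Vᵇ ℕ.* # Vᵇ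
  size³≤|V|⁴ = subst₂ _≤_
    (trans (cong (q ℕ.^_) (ℕ.*-comm 3 n)) (trans (sym (ℕ.^-*-assoc q n 3)) (trans (cong (ℕ._^ 3) (sym size≡qⁿ)) (cube size))))
    (trans (cong (ℕ._^ 4) (card≡# V?)) (fourth (# Vᵇ)))
    where
      cube : ∀ m → m ℕ.* (m ℕ.* (m ℕ.* 1)) ≡ m ℕ.* m ℕ.* m
      cube = solve-∀
      fourth : ∀ m → m ℕ.* (m ℕ.* (m ℕ.* (m ℕ.* 1))) ≡ m ℕ.* m ℕ.* m ℕ.* m
      fourth = solve-∀

  all-within-2 : (∃[ u ] ¬ V u) → q ℕ.^ (3 ℕ.* n) ≤ card V? ℕ.^ 4 → ∀ {b} → b ≢ 0# → ∀ x y → Within (Adj b V) 2 x y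
  all-within-2 (u , u∉V) q³ⁿ≤|V|⁴ {b} b≢0 x y with x ≟ y
  ... | yes x≡y = inj₁ x≡y
  ... | no x≢y with 3≤#⇒member-avoiding _ x y (3≤#common (dec-false (V? u) u∉V) (size³≤|V|⁴ q³ⁿ≤|V|⁴))
    where open CommonNeighbours 2<q H-sub q#H≡size Vᵇ-sub b b≢0 x y x≢y using (3≤#common)
  ... | z , z∈ , z≢x , z≢y with ∧-true⇒ z∈
  ...   | xz∈V , zy∈V = inj₂ (z , (x≢z , does⇒ (V? _) xz∈V) , inj₂ (y , (z≢y , does⇒ (V? _) zy∈V) , refl))
    where
      x≢z : x ≢ z
      x≢z x≡z = z≢x (sym x≡z)

  some-not-within-1 : (∃[ u ] ¬ V u) → ∀ b → ∃[ x ] ∃[ y ] ¬ Within (Adj b V) 1 x y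
  some-not-within-1 (u , u∉V) b with square-outside 2<q Vᵇ-sub (dec-false (V? u) u∉V)
  ... | s , s²∉V = s , 0# , not-within
    where
      s²∉V′ : ¬ V (s * s)
      s²∉V′ s²∈V = ∈⇒∉⇒⊥ {Vᵇ} (dec-true (V? (s * s)) s²∈V) s²∉V
      not-within : ¬ Within (Adj b V) 1 s 0#
      not-within (inj₁ refl) = s²∉V′ (subst V (sym (zeroˡ 0#)) (IsSubspace.zero∈ V-subspace))
      not-within (inj₂ (_ , (_ , Q∈V) , refl)) = s²∉V′ (subst V Qb-s-0 Q∈V)
        where
          Qb-s-0 : Qb b s 0# ≡ s * s
          Qb-s-0 = trans (cong₂ (λ t t′ → s * s + t + t′) (zeroʳ (b * s)) (zeroˡ 0#)) (trans (+-identityʳ _) (+-identityʳ _))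

-- Imported only here: unqualified, these would clash with the field operations above.
open import Data.Nat using (_^_; _*_)

theorem1p6 : (q n : ℕ) → Prime q → q ≢ 2 → 2 ≤ n →
    (K : FiniteField) → FiniteField.size K ≡ q ^ n →
    (V : Pred (FiniteField.F K) 0ℓ) → (V? : Decidable V) →
    FiniteField.IsSubspace K q V → (∃[ x ] ¬ V x) →
    q ^ (3 * n) ≤ FiniteField.card K V? ^ 4 →
    (b : FiniteField.F K) → b ≢ FiniteField.0# K →
    FiniteField.HasDiameter K (FiniteField.Adj K b V) 2
theorem1p6 q n q-prime q≢2 2≤n K size≡qⁿ V V? V-subspace V-proper q³ⁿ≤|V|⁴ b b≢0 =
  all-within-2 V-proper q³ⁿ≤|V|⁴ b≢0 , not-all-within-1
  where
    open FieldTheory K using (Within; Adj; 0#; 1#; 0≢1)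
    open Diameter K q-prime q≢2 2≤n size≡qⁿ V? V-subspace
    not-all-within-1 : ∀ k → k < 2 → ∃[ x ] ∃[ y ] ¬ Within (Adj b V) k x y
    not-all-within-1 zero _ = 0# , 1# , 0≢1
    not-all-within-1 (suc zero) _ = some-not-within-1 V-proper b
    not-all-within-1 (suc (suc _)) (s≤s (s≤s ()))
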